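{- For $i,j\ge 0$ let $c^{(2)}_{i,j}$ be the number of standard paths whose final composition has exactly $i$ parts equal to $1$, exactly $j$ parts equal to $2$, and no other parts. Put $P(x,y)=\sum_{i,j\ge 0}c^{(2)}_{i,j}\,x^i\,\frac{y^j}{j!}$. Then \[ P(x,y)=\frac{2}{1+\sqrt{1-4(y+x-x^2)}}. \]
   Context: A composition is a finite sequence $P=(p_1,\dots,p_k)$ of positive integers (its parts); the empty composition $()$ is allowed, and the weight of $P$ is $p_1+\cdots+p_k$. $Q$ covers $P=(p_1,\dots,p_k)$ if $Q$ is one of $(1,p_1,\dots,p_k)$, $(p_1,\dots,p_k,1)$, or $(p_1,\dots,p_i+1,\dots,p_k)$ for some $1\le i\le k$. A standard path of length $n$ is a sequence $(P_0,P_1,\dots,P_n)$ of compositions with $P_i$ of weight $i$ and $P_{i+1}$ covering $P_i$ for each $i$; its final composition is $P_n$. Standard paths are distinct iff they differ as sequences of compositions. The identity is one of formal power series in $x,y$ (the square root being the power series with constant term $1$). -}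

module Defs where

open import Data.Bool using (Bool; true; false; _∧_; _∨_; T)
open import Data.Nat as ℕ using (ℕ; zero; suc; _∸_; _≡ᵇ_; _≤ᵇ_; _!)
open import Data.Nat.Properties using (_!≢0)
open import Data.List using (List; []; _∷_; _++_; [_]; length; upTo; map; foldr)
open import Data.Bool.ListAction using (all; any)
open import Data.Nat.ListAction using (sum)
import Data.List as L
open import Data.List.Properties using (≡-dec)
open import Data.Vec using (Vec; []; _∷_; last)
open import Data.Integer using (+_)
open import Data.Rational using (ℚ; 0ℚ; 1ℚ; _/_)
import Data.Rational as Q
open import Data.Product using (Σ; _×_; _,_)
open import Function.Bundles using (_↔_)
open import Relation.Nullary.Decidable using (⌊_⌋)
open import Relation.Binary.PropositionalEquality using (_≡_)
open import Data.Fin using (Fin)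

Composition : Set
Composition = List ℕ

isComposition : List ℕ → Bool
isComposition = all (λ p → 1 ≤ᵇ p)

weight : List ℕ → ℕ
weight = sum

_=ᶜ_ : List ℕ → List ℕ → Bool
P =ᶜ Q = ⌊ ≡-dec ℕ._≟_ P Q ⌋

-- add 1 to the k-th part (0-based); used only for k < length P
incAt : ℕ → List ℕ → List ℕ
incAt k       []       = []
incAt zero    (p ∷ ps) = suc p ∷ ps
incAt (suc k) (p ∷ ps) = p ∷ incAt k ps

covers : List ℕ → List ℕ → Bool
covers Q P = (Q =ᶜ (1 ∷ P)) ∨ (Q =ᶜ (P ++ [ 1 ])) ∨
             any (λ k → Q =ᶜ incAt k P) (upTo (length P))

-- Standard paths (P₀, P₁, …, Pₙ), stored as a vector of length n+1.

weightsOK : ∀ {m} → ℕ → Vec (List ℕ) m → Bool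
weightsOK k []       = true
weightsOK k (P ∷ Ps) = isComposition P ∧ (weight P ≡ᵇ k) ∧ weightsOK (suc k) Ps

coverChain : ∀ {m} → List ℕ → Vec (List ℕ) m → Bool
coverChain P []       = true
coverChain P (Q ∷ Qs) = covers Q P ∧ coverChain Q Qs

isStandardPath : ∀ {n} → Vec (List ℕ) (suc n) → Bool
isStandardPath (P₀ ∷ Ps) = weightsOK 0 (P₀ ∷ Ps) ∧ coverChain P₀ Ps

count : ℕ → List ℕ → ℕ
count a P = length (L.filter (λ p → p ℕ.≟ a) P)

finalShape : ℕ → ℕ → List ℕ → Bool
finalShape i j P = (count 1 P ≡ᵇ i) ∧ (count 2 P ≡ᵇ j) ∧
                   all (λ p → (p ≡ᵇ 1) ∨ (p ≡ᵇ 2)) P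

-- Paths are identified
-- with their sequences of compositions (the proof component is T of a Bool).
PathsC2 : ℕ → ℕ → Set
PathsC2 i j = Σ ℕ λ n → Σ (Vec (List ℕ) (suc n)) λ Ps →
              T (isStandardPath Ps ∧ finalShape i j (last Ps))

Counts : (ℕ → ℕ → ℕ) → Set
Counts c = ∀ i j → Fin (c i j) ↔ PathsC2 i j

-- Formal power series in x, y over ℚ: coefficient of xⁱ yʲ.

FPS : Set
FPS = ℕ → ℕ → ℚ

Σ≤ : ℕ → (ℕ → ℚ) → ℚ
Σ≤ n f = foldr Q._+_ 0ℚ (map f (upTo (suc n)))

_⊕_ : FPS → FPS → FPS
(f ⊕ g) i j = f i j Q.+ g i j

_⊖_ : FPS → FPS → FPS
(f ⊖ g) i j = f i j Q.- g i j

_⊛_ : FPS → FPS → FPS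
(f ⊛ g) i j = Σ≤ i λ a → Σ≤ j λ b → f a b Q.* g (i ∸ a) (j ∸ b)

_·_ : ℚ → FPS → FPS
(r · f) i j = r Q.* f i j

mono : ℕ → ℕ → FPS
mono a b i j with (i ≡ᵇ a) ∧ (j ≡ᵇ b)
... | true  = 1ℚ
... | false = 0ℚ

𝟙 𝕩 𝕪 : FPS
𝟙 = mono 0 0
𝕩 = mono 1 0
𝕪 = mono 0 1

radicand : FPS
radicand = 𝟙 ⊖ ((+ 4 / 1) · ((𝕪 ⊕ 𝕩) ⊖ (𝕩 ⊛ 𝕩)))

IsSqrt : FPS → FPS → Set
IsSqrt D S = (∀ i j → (S ⊛ S) i j ≡ D i j) × S 0 0 ≡ 1ℚ

Pseries : (ℕ → ℕ → ℕ) → FPS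
Pseries c i j = (+ c i j / (j !)) {{j !≢0}}

{-# OPTIONS --safe #-}

-- Sorting standard paths by their last covering step (prepend a 1, append a 1, or raise one of the
-- ones of the previous composition to a 2) gives c(i,0) = 1, c(0,j+1) = c(1,j) and
-- c(i+1,j+1) = 2 c(i,j+1) + (i+2) c(i+2,j); appending only yields a new composition when the previous
-- one contains a 2. For P this says D P = 0, where D = ∂ₓ − (1 − 2x) ∂_y is a derivation that also
-- kills u = y + x − x². A series killed by D is determined by its restriction to y = 0. Hence
-- S := 1 − 2uP, which is killed by D and restricts to 1 − 2x (as P(x,0) = 1/(1 − x) and
-- u(x,0) = x − x²), satisfies S² = 1 − 4u and P(1 + S) = 2, since both identities hold at y = 0.
-- Square roots with constant term 1 are unique: (S′ − S)(S′ + S) = 0 and S′ + S has constant term 2.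

module Submission where

open import Defs
open import Data.Nat using (ℕ)
open import Data.Rational using (ℚ; _/_)
open import Data.Integer using (+_)
open import Data.Product using (Σ; _×_)
open import Relation.Binary.PropositionalEquality using (_≡_)
open import Data.Product using (_,_)
open import Relation.Binary.PropositionalEquality using (refl; module ≡-Reasoning)

module Rationals where

  open import Data.Nat as ℕ using (suc)
  import Data.Integer as ℤ
  import Data.Integer.Properties as ℤ
  open import Data.Rational using (1ℚ; _+_; _*_; NonZero; 1/_)
  open import Data.Rational.Literals using (fromℤ)
  open import Data.Rational.Properties
  import Data.Rational.Unnormalised as ℚᵘ
  import Data.Rational.Unnormalised.Properties as ℚᵘ
  open import Relation.Binary.PropositionalEquality

  ι : ℕ → ℚ
  ι n = fromℤ (+ n)

  ι-+ : ∀ m n → ι (m ℕ.+ n) ≡ ι m + ι n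
  ι-+ m n = toℚᵘ-injective (ℚᵘ.≃-trans (ℚᵘ.*≡* numerators) (ℚᵘ.≃-sym (toℚᵘ-homo-+ (ι m) (ι n))))
    where
    numerators : + (m ℕ.+ n) ℤ.* + 1 ≡ (+ m ℤ.* + 1 ℤ.+ + n ℤ.* + 1) ℤ.* + 1
    numerators = cong (ℤ._* + 1)
      (trans (ℤ.pos-+ m n) (sym (cong₂ ℤ._+_ (ℤ.*-identityʳ (+ m)) (ℤ.*-identityʳ (+ n)))))

  ι-* : ∀ m n → ι (m ℕ.* n) ≡ ι m * ι n
  ι-* m n = toℚᵘ-injective (ℚᵘ.≃-trans (ℚᵘ.*≡* numerators) (ℚᵘ.≃-sym (toℚᵘ-homo-* (ι m) (ι n))))
    where
    numerators : + (m ℕ.* n) ℤ.* + 1 ≡ (+ m ℤ.* + n) ℤ.* + 1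
    numerators = cong (ℤ._* + 1) (ℤ.pos-* m n)

  a/d*d≡a : ∀ a d .{{_ : ℕ.NonZero d}} → (+ a / d) * ι d ≡ ι a
  a/d*d≡a a (suc d) = toℚᵘ-injective (ℚᵘ.≃-trans (toℚᵘ-homo-* (+ a / suc d) (ι (suc d)))
    (ℚᵘ.≃-trans (ℚᵘ.*-congʳ (toℚᵘ-fromℚᵘ (ℚᵘ.mkℚᵘ (+ a) d)))
      (ℚᵘ.*≡* (ℤ.*-assoc (+ a) (+ suc d) (+ 1)))))

  *-cancelˡ-≡ : ∀ r {p q} .{{_ : NonZero r}} → r * p ≡ r * q → p ≡ q
  *-cancelˡ-≡ r {p} {q} rp≡rq = begin
    p                ≡⟨ sym (*-identityˡ p) ⟩
    1ℚ * p           ≡⟨ cong (_* p) (sym (*-inverseˡ r)) ⟩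
    (1/ r * r) * p   ≡⟨ *-assoc (1/ r) r p ⟩
    1/ r * (r * p)   ≡⟨ cong (1/ r *_) rp≡rq ⟩
    1/ r * (r * q)   ≡⟨ sym (*-assoc (1/ r) r q) ⟩
    (1/ r * r) * q   ≡⟨ cong (_* q) (*-inverseˡ r) ⟩
    1ℚ * q           ≡⟨ *-identityˡ q ⟩
    q                ∎
    where open ≡-Reasoning

  *-cancelʳ-≡ : ∀ r {p q} .{{_ : NonZero r}} → p * r ≡ q * r → p ≡ q
  *-cancelʳ-≡ r {p} {q} pr≡qr = *-cancelˡ-≡ r (trans (*-comm r p) (trans pr≡qr (*-comm q r)))

module FiniteSums where

  open Rationals
  open import Data.Nat as ℕ using (zero; suc; _∸_; _<_; _≤_; s≤s)
  import Data.Nat.Properties as ℕ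
  open import Data.List using (map; foldr; applyUpTo)
  open import Data.Rational using (0ℚ; _+_; _*_; _-_; -_)
  open import Data.Rational.Properties
  open import Algebra.Bundles using (CommutativeRing)
  open CommutativeRing +-*-commutativeRing using (+-commutativeSemigroup)
  open import Algebra.Properties.CommutativeSemigroup +-commutativeSemigroup using (interchange)
  open import Relation.Binary.PropositionalEquality

  ∑< : ℕ → (ℕ → ℚ) → ℚ
  ∑< zero    f = 0ℚ
  ∑< (suc n) f = f 0 + ∑< n (λ a → f (suc a))

  Σ≤-∑< : ∀ n f → Σ≤ n f ≡ ∑< (suc n) f
  Σ≤-∑< n f = go (suc n) (λ a → a)
    where
    go : ∀ m (g : ℕ → ℕ) → foldr _+_ 0ℚ (map f (applyUpTo g m)) ≡ ∑< m (λ a → f (g a))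
    go zero    g = refl
    go (suc m) g = cong (λ s → f (g 0) + s) (go m (λ a → g (suc a)))

  ∑<-cong : ∀ n {f g : ℕ → ℚ} → (∀ a → a < n → f a ≡ g a) → ∑< n f ≡ ∑< n g
  ∑<-cong zero    f≡g = refl
  ∑<-cong (suc n) f≡g = cong₂ _+_ (f≡g 0 ℕ.z<s) (∑<-cong n (λ a a<n → f≡g (suc a) (s≤s a<n)))

  ∑<-zero : ∀ n {f : ℕ → ℚ} → (∀ a → a < n → f a ≡ 0ℚ) → ∑< n f ≡ 0ℚ
  ∑<-zero n f≡0 = trans (∑<-cong n f≡0) (zeros n)
    where
    zeros : ∀ n → ∑< n (λ _ → 0ℚ) ≡ 0ℚ
    zeros zero    = refl
    zeros (suc n) = trans (+-identityˡ _) (zeros n)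

  ∑<-+ : ∀ n (f g : ℕ → ℚ) → ∑< n (λ a → f a + g a) ≡ ∑< n f + ∑< n g
  ∑<-+ zero    f g = sym (+-identityˡ 0ℚ)
  ∑<-+ (suc n) f g = trans (cong (λ s → f 0 + g 0 + s) (∑<-+ n (λ a → f (suc a)) (λ a → g (suc a))))
                           (interchange (f 0) (g 0) _ _)

  ∑<-neg : ∀ n (f : ℕ → ℚ) → ∑< n (λ a → - f a) ≡ - ∑< n f
  ∑<-neg zero    f = refl
  ∑<-neg (suc n) f = trans (cong (λ s → - f 0 + s) (∑<-neg n (λ a → f (suc a)))) (sym (neg-distrib-+ (f 0) _))

  ∑<-- : ∀ n (f g : ℕ → ℚ) → ∑< n (λ a → f a - g a) ≡ ∑< n f - ∑< n g
  ∑<-- n f g = trans (∑<-+ n f (λ a → - g a)) (cong (λ s → ∑< n f + s) (∑<-neg n g))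

  ∑<-*ˡ : ∀ n k (f : ℕ → ℚ) → ∑< n (λ a → k * f a) ≡ k * ∑< n f
  ∑<-*ˡ zero    k f = sym (*-zeroʳ k)
  ∑<-*ˡ (suc n) k f = trans (cong (λ s → k * f 0 + s) (∑<-*ˡ n k (λ a → f (suc a))))
                            (sym (*-distribˡ-+ k (f 0) _))

  ∑<-last : ∀ n (f : ℕ → ℚ) → ∑< (suc n) f ≡ ∑< n f + f n
  ∑<-last zero    f = trans (+-identityʳ (f 0)) (sym (+-identityˡ (f 0)))
  ∑<-last (suc n) f = trans (cong (λ s → f 0 + s) (∑<-last n (λ a → f (suc a)))) (sym (+-assoc (f 0) _ _))

  ∑<-reverse : ∀ n (f : ℕ → ℚ) → ∑< (suc n) f ≡ ∑< (suc n) (λ a → f (n ∸ a))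
  ∑<-reverse zero    f = refl
  ∑<-reverse (suc n) f = begin
    f 0 + ∑< (suc n) (λ a → f (suc a))
      ≡⟨ cong (λ s → f 0 + s) (∑<-reverse n (λ a → f (suc a))) ⟩
    f 0 + ∑< (suc n) (λ a → f (suc (n ∸ a)))
      ≡⟨ +-comm (f 0) _ ⟩
    ∑< (suc n) (λ a → f (suc (n ∸ a))) + f 0
      ≡⟨ cong₂ _+_ (∑<-cong (suc n) (λ a a<1+n → cong f (sym (ℕ.+-∸-assoc 1 (ℕ.<⇒≤pred a<1+n)))))
                   (cong f (sym (ℕ.n∸n≡0 (suc n)))) ⟩
    ∑< (suc n) (λ a → f (suc n ∸ a)) + f (suc n ∸ suc n)
      ≡⟨ sym (∑<-last (suc n) (λ a → f (suc n ∸ a))) ⟩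
    ∑< (suc (suc n)) (λ a → f (suc n ∸ a)) ∎
    where open ≡-Reasoning

  ∑<-only-last : ∀ n {f : ℕ → ℚ} → (∀ a → a < n → f a ≡ 0ℚ) → ∑< (suc n) f ≡ f n
  ∑<-only-last n {f} f≡0 = trans (∑<-last n f) (trans (cong (_+ f n) (∑<-zero n f≡0)) (+-identityˡ (f n)))

  ∑ₐ : ℕ → (ℕ → ℕ → ℚ) → ℚ
  ∑ₐ n φ = ∑< (suc n) (λ a → φ a (n ∸ a))

  ∑ₐ-cong : ∀ n {φ ψ : ℕ → ℕ → ℚ} → (∀ a b → φ a b ≡ ψ a b) → ∑ₐ n φ ≡ ∑ₐ n ψ
  ∑ₐ-cong n φ≡ψ = ∑<-cong (suc n) (λ a _ → φ≡ψ a (n ∸ a))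

  ∑ₐ-+ : ∀ n (φ ψ : ℕ → ℕ → ℚ) → ∑ₐ n (λ a b → φ a b + ψ a b) ≡ ∑ₐ n φ + ∑ₐ n ψ
  ∑ₐ-+ n φ ψ = ∑<-+ (suc n) (λ a → φ a (n ∸ a)) (λ a → ψ a (n ∸ a))

  ∑ₐ-- : ∀ n (φ ψ : ℕ → ℕ → ℚ) → ∑ₐ n (λ a b → φ a b - ψ a b) ≡ ∑ₐ n φ - ∑ₐ n ψ
  ∑ₐ-- n φ ψ = ∑<-- (suc n) (λ a → φ a (n ∸ a)) (λ a → ψ a (n ∸ a))

  ∑ₐ-*ˡ : ∀ n k (φ : ℕ → ℕ → ℚ) → ∑ₐ n (λ a b → k * φ a b) ≡ k * ∑ₐ n φ
  ∑ₐ-*ˡ n k φ = ∑<-*ˡ (suc n) k (λ a → φ a (n ∸ a))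

  ∑ₐ-swap : ∀ n (φ : ℕ → ℕ → ℚ) → ∑ₐ n φ ≡ ∑ₐ n (λ a b → φ b a)
  ∑ₐ-swap n φ = trans (∑<-reverse n (λ a → φ a (n ∸ a)))
    (∑<-cong (suc n) (λ a a<1+n → cong (φ (n ∸ a)) (ℕ.m∸[m∸n]≡n (ℕ.<⇒≤pred a<1+n))))

  -- Split the weight n + 1 as a + (n + 1 − a) and shift the two resulting sums.
  ∑ₐ-leibniz : ∀ n (φ : ℕ → ℕ → ℚ) →
    ι (suc n) * ∑ₐ (suc n) φ ≡
    ∑ₐ n (λ a b → ι (suc a) * φ (suc a) b) + ∑ₐ n (λ a b → ι (suc b) * φ a (suc b))
  ∑ₐ-leibniz n φ = sym (begin
    ∑ₐ n (λ a b → ι (suc a) * φ (suc a) b) + ∑ₐ n (λ a b → ι (suc b) * φ a (suc b))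
      ≡⟨ cong₂ _+_ shiftˡ shiftʳ ⟩
    ∑< (suc (suc n)) (λ a → ι a * ψ a) + ∑< (suc (suc n)) (λ a → ι (suc n ∸ a) * ψ a)
      ≡⟨ sym (∑<-+ (suc (suc n)) (λ a → ι a * ψ a) (λ a → ι (suc n ∸ a) * ψ a)) ⟩
    ∑< (suc (suc n)) (λ a → ι a * ψ a + ι (suc n ∸ a) * ψ a)
      ≡⟨ ∑<-cong (suc (suc n)) (λ a a<2+n → weights a (ℕ.<⇒≤pred a<2+n)) ⟩
    ∑< (suc (suc n)) (λ a → ι (suc n) * ψ a)
      ≡⟨ ∑<-*ˡ (suc (suc n)) (ι (suc n)) ψ ⟩
    ι (suc n) * ∑ₐ (suc n) φ ∎)
    where
    open ≡-Reasoning
    ψ : ℕ → ℚ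
    ψ a = φ a (suc n ∸ a)
    shiftˡ : ∑ₐ n (λ a b → ι (suc a) * φ (suc a) b) ≡ ∑< (suc (suc n)) (λ a → ι a * ψ a)
    shiftˡ = sym (trans (cong (_+ ∑< (suc n) (λ a → ι (suc a) * ψ (suc a))) (*-zeroˡ (ψ 0))) (+-identityˡ _))
    shiftʳ : ∑ₐ n (λ a b → ι (suc b) * φ a (suc b)) ≡ ∑< (suc (suc n)) (λ a → ι (suc n ∸ a) * ψ a)
    shiftʳ = sym (begin
      ∑< (suc (suc n)) (λ a → ι (suc n ∸ a) * ψ a)
        ≡⟨ ∑<-last (suc n) (λ a → ι (suc n ∸ a) * ψ a) ⟩
      ∑< (suc n) (λ a → ι (suc n ∸ a) * ψ a) + ι (suc n ∸ suc n) * ψ (suc n)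
        ≡⟨ cong (λ s → ∑< (suc n) (λ a → ι (suc n ∸ a) * ψ a) + s)
                (trans (cong (λ m → ι m * ψ (suc n)) (ℕ.n∸n≡0 n)) (*-zeroˡ (ψ (suc n)))) ⟩
      ∑< (suc n) (λ a → ι (suc n ∸ a) * ψ a) + 0ℚ
        ≡⟨ +-identityʳ (∑< (suc n) (λ a → ι (suc n ∸ a) * ψ a)) ⟩
      ∑< (suc n) (λ a → ι (suc n ∸ a) * ψ a)
        ≡⟨ ∑<-cong (suc n) (λ a a<1+n → cong (λ m → ι m * φ a m) (ℕ.+-∸-assoc 1 (ℕ.<⇒≤pred a<1+n))) ⟩
      ∑ₐ n (λ a b → ι (suc b) * φ a (suc b)) ∎)
    weights : ∀ a → a ≤ suc n → ι a * ψ a + ι (suc n ∸ a) * ψ a ≡ ι (suc n) * ψ a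
    weights a a≤1+n = trans (sym (*-distribʳ-+ (ψ a) (ι a) (ι (suc n ∸ a))))
                            (cong (_* ψ a) (trans (sym (ι-+ a (suc n ∸ a))) (cong ι (ℕ.m+[n∸m]≡n a≤1+n))))

module PowerSeries where

  open Rationals
  open FiniteSums
  open import Data.Nat as ℕ using (zero; suc; _∸_; _<_)
  import Data.Nat.Properties as ℕ
  open import Data.Nat.Induction using (<-rec)
  open import Data.Rational using (0ℚ; 1ℚ; _+_; _*_; _-_; ≢-nonZero)
  open import Data.Rational.Properties
  open import Data.Rational.Solver using (module +-*-Solver)
  open +-*-Solver using (solve; _:+_; _:-_; _:=_)
  open import Algebra.Bundles using (CommutativeRing)
  open import Algebra.Properties.Ring +-*-ring using ([y-z]x≈yx-zx)
  open import Algebra.Properties.Group (CommutativeRing.+-group +-*-commutativeRing) using (x∙y⁻¹≈ε⇒x≈y)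
  open import Relation.Binary.PropositionalEquality

  infix 4 _≐_
  _≐_ : FPS → FPS → Set
  F ≐ G = ∀ i j → F i j ≡ G i j

  𝟘 : FPS
  𝟘 _ _ = 0ℚ

  ⊕-cong : ∀ {F F′ G G′} → F ≐ F′ → G ≐ G′ → F ⊕ G ≐ F′ ⊕ G′
  ⊕-cong F≐F′ G≐G′ i j = cong₂ _+_ (F≐F′ i j) (G≐G′ i j)

  ⊛-∑ₐ : ∀ F G i j → (F ⊛ G) i j ≡ ∑ₐ i (λ a a′ → ∑ₐ j (λ b b′ → F a b * G a′ b′))
  ⊛-∑ₐ F G i j = trans (Σ≤-∑< i (λ a → Σ≤ j (λ b → F a b * G (i ∸ a) (j ∸ b))))
                       (∑<-cong (suc i) (λ a _ → Σ≤-∑< j (λ b → F a b * G (i ∸ a) (j ∸ b))))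

  ⊛-cong : ∀ {F F′ G G′} → F ≐ F′ → G ≐ G′ → F ⊛ G ≐ F′ ⊛ G′
  ⊛-cong {F} {F′} {G} {G′} F≐F′ G≐G′ i j = begin
    (F ⊛ G) i j
      ≡⟨ ⊛-∑ₐ F G i j ⟩
    ∑ₐ i (λ a a′ → ∑ₐ j (λ b b′ → F a b * G a′ b′))
      ≡⟨ ∑ₐ-cong i (λ a a′ → ∑ₐ-cong j (λ b b′ → cong₂ _*_ (F≐F′ a b) (G≐G′ a′ b′))) ⟩
    ∑ₐ i (λ a a′ → ∑ₐ j (λ b b′ → F′ a b * G′ a′ b′))
      ≡⟨ sym (⊛-∑ₐ F′ G′ i j) ⟩
    (F′ ⊛ G′) i j ∎
    where open ≡-Reasoning

  ⊛-comm : ∀ F G → F ⊛ G ≐ G ⊛ F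
  ⊛-comm F G i j = begin
    (F ⊛ G) i j
      ≡⟨ ⊛-∑ₐ F G i j ⟩
    ∑ₐ i (λ a a′ → ∑ₐ j (λ b b′ → F a b * G a′ b′))
      ≡⟨ ∑ₐ-swap i (λ a a′ → ∑ₐ j (λ b b′ → F a b * G a′ b′)) ⟩
    ∑ₐ i (λ a a′ → ∑ₐ j (λ b b′ → F a′ b * G a b′))
      ≡⟨ ∑ₐ-cong i (λ a a′ → ∑ₐ-swap j (λ b b′ → F a′ b * G a b′)) ⟩
    ∑ₐ i (λ a a′ → ∑ₐ j (λ b b′ → F a′ b′ * G a b))
      ≡⟨ ∑ₐ-cong i (λ a a′ → ∑ₐ-cong j (λ b b′ → *-comm (F a′ b′) (G a b))) ⟩
    ∑ₐ i (λ a a′ → ∑ₐ j (λ b b′ → G a b * F a′ b′))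
      ≡⟨ sym (⊛-∑ₐ G F i j) ⟩
    (G ⊛ F) i j ∎
    where open ≡-Reasoning

  ⊛-distribʳ-⊕ : ∀ F G H → (F ⊕ G) ⊛ H ≐ (F ⊛ H) ⊕ (G ⊛ H)
  ⊛-distribʳ-⊕ F G H i j = begin
    ((F ⊕ G) ⊛ H) i j
      ≡⟨ ⊛-∑ₐ (F ⊕ G) H i j ⟩
    ∑ₐ i (λ a a′ → ∑ₐ j (λ b b′ → (F a b + G a b) * H a′ b′))
      ≡⟨ ∑ₐ-cong i (λ a a′ → trans (∑ₐ-cong j (λ b b′ → *-distribʳ-+ (H a′ b′) (F a b) (G a b)))
                                     (∑ₐ-+ j (λ b b′ → F a b * H a′ b′) (λ b b′ → G a b * H a′ b′))) ⟩
    ∑ₐ i (λ a a′ → FH a a′ + GH a a′)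
      ≡⟨ ∑ₐ-+ i FH GH ⟩
    ∑ₐ i FH + ∑ₐ i GH
      ≡⟨ sym (cong₂ _+_ (⊛-∑ₐ F H i j) (⊛-∑ₐ G H i j)) ⟩
    ((F ⊛ H) ⊕ (G ⊛ H)) i j ∎
    where
    open ≡-Reasoning
    FH GH : ℕ → ℕ → ℚ
    FH a a′ = ∑ₐ j (λ b b′ → F a b * H a′ b′)
    GH a a′ = ∑ₐ j (λ b b′ → G a b * H a′ b′)

  ⊛-distribʳ-⊖ : ∀ F G H → (F ⊖ G) ⊛ H ≐ (F ⊛ H) ⊖ (G ⊛ H)
  ⊛-distribʳ-⊖ F G H i j = begin
    ((F ⊖ G) ⊛ H) i j
      ≡⟨ ⊛-∑ₐ (F ⊖ G) H i j ⟩
    ∑ₐ i (λ a a′ → ∑ₐ j (λ b b′ → (F a b - G a b) * H a′ b′))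
      ≡⟨ ∑ₐ-cong i (λ a a′ → trans (∑ₐ-cong j (λ b b′ → [y-z]x≈yx-zx (H a′ b′) (F a b) (G a b)))
                                     (∑ₐ-- j (λ b b′ → F a b * H a′ b′) (λ b b′ → G a b * H a′ b′))) ⟩
    ∑ₐ i (λ a a′ → FH a a′ - GH a a′)
      ≡⟨ ∑ₐ-- i FH GH ⟩
    ∑ₐ i FH - ∑ₐ i GH
      ≡⟨ sym (cong₂ _-_ (⊛-∑ₐ F H i j) (⊛-∑ₐ G H i j)) ⟩
    ((F ⊛ H) ⊖ (G ⊛ H)) i j ∎
    where
    open ≡-Reasoning
    FH GH : ℕ → ℕ → ℚ
    FH a a′ = ∑ₐ j (λ b b′ → F a b * H a′ b′)
    GH a a′ = ∑ₐ j (λ b b′ → G a b * H a′ b′)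

  ⊛-·ˡ : ∀ r F G → (r · F) ⊛ G ≐ r · (F ⊛ G)
  ⊛-·ˡ r F G i j = begin
    ((r · F) ⊛ G) i j
      ≡⟨ ⊛-∑ₐ (r · F) G i j ⟩
    ∑ₐ i (λ a a′ → ∑ₐ j (λ b b′ → r * F a b * G a′ b′))
      ≡⟨ ∑ₐ-cong i (λ a a′ → trans (∑ₐ-cong j (λ b b′ → *-assoc r (F a b) (G a′ b′)))
                                     (∑ₐ-*ˡ j r (λ b b′ → F a b * G a′ b′))) ⟩
    ∑ₐ i (λ a a′ → r * ∑ₐ j (λ b b′ → F a b * G a′ b′))
      ≡⟨ ∑ₐ-*ˡ i r (λ a a′ → ∑ₐ j (λ b b′ → F a b * G a′ b′)) ⟩
    r * ∑ₐ i (λ a a′ → ∑ₐ j (λ b b′ → F a b * G a′ b′))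
      ≡⟨ cong (r *_) (sym (⊛-∑ₐ F G i j)) ⟩
    (r · (F ⊛ G)) i j ∎
    where open ≡-Reasoning

  ⊛-zeroˡ : ∀ G → 𝟘 ⊛ G ≐ 𝟘
  ⊛-zeroˡ G i j = trans (⊛-∑ₐ 𝟘 G i j)
    (∑<-zero (suc i) (λ a _ → ∑<-zero (suc j) (λ b _ → *-zeroˡ (G (i ∸ a) (j ∸ b)))))

  ⊛-identityˡ : ∀ F → 𝟙 ⊛ F ≐ F
  ⊛-identityˡ F i j = begin
    (𝟙 ⊛ F) i j
      ≡⟨ ⊛-∑ₐ 𝟙 F i j ⟩
    ∑< (suc i) (λ a → ∑ₐ j (λ b b′ → 𝟙 a b * F (i ∸ a) b′))
      ≡⟨ cong (λ s → ∑ₐ j (λ b b′ → 𝟙 0 b * F i b′) + s)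
              (∑<-zero i (λ a _ → ∑<-zero (suc j) (λ b _ → *-zeroˡ (F (i ∸ suc a) (j ∸ b))))) ⟩
    ∑< (suc j) (λ b → 𝟙 0 b * F i (j ∸ b)) + 0ℚ
      ≡⟨ +-identityʳ _ ⟩
    1ℚ * F i j + ∑< j (λ b → 𝟙 0 (suc b) * F i (j ∸ suc b))
      ≡⟨ cong₂ _+_ (*-identityˡ (F i j)) (∑<-zero j (λ b _ → *-zeroˡ (F i (j ∸ suc b)))) ⟩
    F i j + 0ℚ
      ≡⟨ +-identityʳ (F i j) ⟩
    F i j ∎
    where open ≡-Reasoning

  ⊛-difference-of-squares : ∀ A B → (A ⊖ B) ⊛ (A ⊕ B) ≐ (A ⊛ A) ⊖ (B ⊛ B)
  ⊛-difference-of-squares A B i j = begin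
    ((A ⊖ B) ⊛ (A ⊕ B)) i j
      ≡⟨ ⊛-distribʳ-⊖ A B (A ⊕ B) i j ⟩
    (A ⊛ (A ⊕ B)) i j - (B ⊛ (A ⊕ B)) i j
      ≡⟨ cong₂ _-_ (expand A) (expand B) ⟩
    ((A ⊛ A) i j + (B ⊛ A) i j) - ((A ⊛ B) i j + (B ⊛ B) i j)
      ≡⟨ cong (λ t → ((A ⊛ A) i j + (B ⊛ A) i j) - (t + (B ⊛ B) i j)) (⊛-comm A B i j) ⟩
    ((A ⊛ A) i j + (B ⊛ A) i j) - ((B ⊛ A) i j + (B ⊛ B) i j)
      ≡⟨ solve 3 (λ p q r → (p :+ q) :- (q :+ r) := p :- r) refl ((A ⊛ A) i j) ((B ⊛ A) i j) ((B ⊛ B) i j) ⟩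
    (A ⊛ A) i j - (B ⊛ B) i j ∎
    where
    open ≡-Reasoning
    expand : ∀ X → (X ⊛ (A ⊕ B)) i j ≡ (A ⊛ X) i j + (B ⊛ X) i j
    expand X = trans (⊛-comm X (A ⊕ B) i j) (⊛-distribʳ-⊕ A B X i j)

  ⊛-row₀ : ∀ F G i → (F ⊛ G) i 0 ≡ ∑ₐ i (λ a a′ → F a 0 * G a′ 0)
  ⊛-row₀ F G i = trans (⊛-∑ₐ F G i 0) (∑ₐ-cong i (λ a a′ → +-identityʳ (F a 0 * G a′ 0)))

  ⊛-row₀-partialSums : ∀ F G → (∀ a → G a 0 ≡ 1ℚ) → ∀ i → (F ⊛ G) i 0 ≡ ∑< (suc i) (λ a → F a 0)
  ⊛-row₀-partialSums F G G₀≡1 i = trans (⊛-row₀ F G i)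
    (∑ₐ-cong i (λ a a′ → trans (cong (F a 0 *_) (G₀≡1 a′)) (*-identityʳ (F a 0))))

  ⊛-leading : ∀ F G i j →
    (∀ {a} → a < i → ∀ b → F a b ≡ 0ℚ) → (∀ {b} → b < j → F i b ≡ 0ℚ) → (F ⊛ G) i j ≡ F i j * G 0 0
  ⊛-leading F G i j earlierRows earlierEntries = begin
    (F ⊛ G) i j
      ≡⟨ ⊛-∑ₐ F G i j ⟩
    ∑ₐ i (λ a a′ → ∑ₐ j (λ b b′ → F a b * G a′ b′))
      ≡⟨ ∑<-only-last i (λ a a<i → ∑<-zero (suc j) (λ b _ → vanish (G (i ∸ a) (j ∸ b)) (earlierRows a<i b)))
      ⟩
    ∑ₐ j (λ b b′ → F i b * G (i ∸ i) b′)
      ≡⟨ ∑<-only-last j (λ b b<j → vanish (G (i ∸ i) (j ∸ b)) (earlierEntries b<j)) ⟩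
    F i j * G (i ∸ i) (j ∸ j)
      ≡⟨ cong₂ (λ a b → F i j * G a b) (ℕ.n∸n≡0 i) (ℕ.n∸n≡0 j) ⟩
    F i j * G 0 0 ∎
    where
    open ≡-Reasoning
    vanish : ∀ {f} g → f ≡ 0ℚ → f * g ≡ 0ℚ
    vanish g refl = *-zeroˡ g

  F⊛G≐𝟘⇒F≐𝟘 : ∀ F G → G 0 0 ≢ 0ℚ → F ⊛ G ≐ 𝟘 → F ≐ 𝟘
  F⊛G≐𝟘⇒F≐𝟘 F G G₀₀≢0 FG≐𝟘 =
    <-rec (λ i → ∀ j → F i j ≡ 0ℚ) (λ i earlierRows → <-rec (λ j → F i j ≡ 0ℚ) (entry i earlierRows))
    where
    instance _ = ≢-nonZero G₀₀≢0
    entry : ∀ i → (∀ {a} → a < i → ∀ b → F a b ≡ 0ℚ) →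
            ∀ j → (∀ {b} → b < j → F i b ≡ 0ℚ) → F i j ≡ 0ℚ
    entry i earlierRows j earlierEntries = *-cancelʳ-≡ (G 0 0) (begin
      F i j * G 0 0 ≡⟨ sym (⊛-leading F G i j earlierRows earlierEntries) ⟩
      (F ⊛ G) i j   ≡⟨ FG≐𝟘 i j ⟩
      0ℚ            ≡⟨ sym (*-zeroˡ (G 0 0)) ⟩
      0ℚ * G 0 0    ∎)
      where open ≡-Reasoning

  sqrt-unique : ∀ {R S S′} → IsSqrt R S → IsSqrt R S′ → S′ ≐ S
  sqrt-unique {R} {S} {S′} (S²≐R , S₀₀≡1) (S′²≐R , S′₀₀≡1) i j =
    x∙y⁻¹≈ε⇒x≈y (S′ i j) (S i j) (F⊛G≐𝟘⇒F≐𝟘 (S′ ⊖ S) (S′ ⊕ S) sum₀₀≢0 product≐𝟘 i j)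
    where
    sum₀₀≢0 : S′ 0 0 + S 0 0 ≢ 0ℚ
    sum₀₀≢0 rewrite S₀₀≡1 | S′₀₀≡1 = λ ()
    product≐𝟘 : (S′ ⊖ S) ⊛ (S′ ⊕ S) ≐ 𝟘
    product≐𝟘 a b = begin
      ((S′ ⊖ S) ⊛ (S′ ⊕ S)) a b   ≡⟨ ⊛-difference-of-squares S′ S a b ⟩
      (S′ ⊛ S′) a b - (S ⊛ S) a b ≡⟨ cong₂ _-_ (S′²≐R a b) (S²≐R a b) ⟩
      R a b - R a b               ≡⟨ +-inverseʳ (R a b) ⟩
      0ℚ                          ∎
      where open ≡-Reasoning

  mulX : FPS → FPS
  mulX F zero    j = 0ℚ
  mulX F (suc i) j = F i j

  mulX-cong : ∀ {F G} → F ≐ G → mulX F ≐ mulX G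
  mulX-cong F≐G zero    j = refl
  mulX-cong F≐G (suc i) j = F≐G i j

  mulX-⊛ : ∀ F G → mulX F ⊛ G ≐ mulX (F ⊛ G)
  mulX-⊛ F G zero j = trans (⊛-∑ₐ (mulX F) G 0 j)
    (trans (+-identityʳ _) (∑<-zero (suc j) (λ b _ → *-zeroˡ (G 0 (j ∸ b)))))
  mulX-⊛ F G (suc i) j = begin
    (mulX F ⊛ G) (suc i) j
      ≡⟨ ⊛-∑ₐ (mulX F) G (suc i) j ⟩
    ∑ₐ j (λ b b′ → 0ℚ * G (suc i) b′) + ∑ₐ i (λ a a′ → ∑ₐ j (λ b b′ → F a b * G a′ b′))
      ≡⟨ cong (_+ ∑ₐ i (λ a a′ → ∑ₐ j (λ b b′ → F a b * G a′ b′)))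
              (∑<-zero (suc j) (λ b _ → *-zeroˡ (G (suc i) (j ∸ b)))) ⟩
    0ℚ + ∑ₐ i (λ a a′ → ∑ₐ j (λ b b′ → F a b * G a′ b′))
      ≡⟨ +-identityˡ _ ⟩
    ∑ₐ i (λ a a′ → ∑ₐ j (λ b b′ → F a b * G a′ b′))
      ≡⟨ sym (⊛-∑ₐ F G i j) ⟩
    (F ⊛ G) i j ∎
    where open ≡-Reasoning

  𝕩≐mulX𝟙 : 𝕩 ≐ mulX 𝟙
  𝕩≐mulX𝟙 zero          j       = refl
  𝕩≐mulX𝟙 (suc zero)    zero    = refl
  𝕩≐mulX𝟙 (suc zero)    (suc j) = refl
  𝕩≐mulX𝟙 (suc (suc i)) j       = refl

  𝕩-⊛ : ∀ F → 𝕩 ⊛ F ≐ mulX F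
  𝕩-⊛ F i j = begin
    (𝕩 ⊛ F) i j        ≡⟨ ⊛-cong {G = F} 𝕩≐mulX𝟙 (λ _ _ → refl) i j ⟩
    (mulX 𝟙 ⊛ F) i j   ≡⟨ mulX-⊛ 𝟙 F i j ⟩
    mulX (𝟙 ⊛ F) i j   ≡⟨ mulX-cong (⊛-identityˡ F) i j ⟩
    mulX F i j         ∎
    where open ≡-Reasoning

module Derivation where

  open Rationals
  open FiniteSums
  open PowerSeries
  open import Data.Nat as ℕ using (zero; suc)
  open import Data.Rational using (0ℚ; 1ℚ; _+_; _*_; _-_; -_)
  open import Data.Rational.Properties
  open import Data.Rational.Solver using (module +-*-Solver)
  open +-*-Solver using (solve; _:+_; _:-_; _:*_; _:=_; con)
  open import Algebra.Bundles using (CommutativeRing)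
  open CommutativeRing +-*-commutativeRing using (*-commutativeSemigroup)
  open import Algebra.Properties.CommutativeSemigroup *-commutativeSemigroup using (x∙yz≈y∙xz)
  open import Algebra.Properties.Ring +-*-ring using (-1*x≈-x)
  open import Relation.Binary.PropositionalEquality

  ∂x ∂y : FPS → FPS
  ∂x F i j = ι (suc i) * F (suc i) j
  ∂y F i j = ι (suc j) * F i (suc j)

  ∂x-leibniz : ∀ F G → ∂x (F ⊛ G) ≐ (∂x F ⊛ G) ⊕ (F ⊛ ∂x G)
  ∂x-leibniz F G i j = begin
    ι (suc i) * (F ⊛ G) (suc i) j
      ≡⟨ cong (ι (suc i) *_) (⊛-∑ₐ F G (suc i) j) ⟩
    ι (suc i) * ∑ₐ (suc i) Φ
      ≡⟨ ∑ₐ-leibniz i Φ ⟩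
    ∑ₐ i (λ a a′ → ι (suc a) * Φ (suc a) a′) + ∑ₐ i (λ a a′ → ι (suc a′) * Φ a (suc a′))
      ≡⟨ cong₂ _+_ (∑ₐ-cong i (λ a a′ → scaleˡ (ι (suc a)) (F (suc a)) (G a′)))
                   (∑ₐ-cong i (λ a a′ → scaleʳ (ι (suc a′)) (F a) (G (suc a′)))) ⟩
    ∑ₐ i (λ a a′ → ∑ₐ j (λ b b′ → ∂x F a b * G a′ b′)) +
    ∑ₐ i (λ a a′ → ∑ₐ j (λ b b′ → F a b * ∂x G a′ b′))
      ≡⟨ sym (cong₂ _+_ (⊛-∑ₐ (∂x F) G i j) (⊛-∑ₐ F (∂x G) i j)) ⟩
    ((∂x F ⊛ G) ⊕ (F ⊛ ∂x G)) i j ∎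
    where
    open ≡-Reasoning
    Φ : ℕ → ℕ → ℚ
    Φ a a′ = ∑ₐ j (λ b b′ → F a b * G a′ b′)
    scaleˡ : ∀ k (f g : ℕ → ℚ) →
      k * ∑ₐ j (λ b b′ → f b * g b′) ≡ ∑ₐ j (λ b b′ → (k * f b) * g b′)
    scaleˡ k f g = trans (sym (∑ₐ-*ˡ j k (λ b b′ → f b * g b′)))
                         (∑ₐ-cong j (λ b b′ → sym (*-assoc k (f b) (g b′))))
    scaleʳ : ∀ k (f g : ℕ → ℚ) →
      k * ∑ₐ j (λ b b′ → f b * g b′) ≡ ∑ₐ j (λ b b′ → f b * (k * g b′))
    scaleʳ k f g = trans (sym (∑ₐ-*ˡ j k (λ b b′ → f b * g b′)))
                         (∑ₐ-cong j (λ b b′ → x∙yz≈y∙xz k (f b) (g b′)))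

  ∂y-leibniz : ∀ F G → ∂y (F ⊛ G) ≐ (∂y F ⊛ G) ⊕ (F ⊛ ∂y G)
  ∂y-leibniz F G i j = begin
    ι (suc j) * (F ⊛ G) i (suc j)
      ≡⟨ cong (ι (suc j) *_) (⊛-∑ₐ F G i (suc j)) ⟩
    ι (suc j) * ∑ₐ i (λ a a′ → ∑ₐ (suc j) (Φ a a′))
      ≡⟨ sym (∑ₐ-*ˡ i (ι (suc j)) (λ a a′ → ∑ₐ (suc j) (Φ a a′))) ⟩
    ∑ₐ i (λ a a′ → ι (suc j) * ∑ₐ (suc j) (Φ a a′))
      ≡⟨ ∑ₐ-cong i (λ a a′ → ∑ₐ-leibniz j (Φ a a′)) ⟩
    ∑ₐ i (λ a a′ → left a a′ + right a a′)
      ≡⟨ ∑ₐ-+ i left right ⟩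
    ∑ₐ i left + ∑ₐ i right
      ≡⟨ cong₂ _+_
           (∑ₐ-cong i (λ a a′ → ∑ₐ-cong j (λ b b′ → sym (*-assoc (ι (suc b)) (F a (suc b)) (G a′ b′)))))
           (∑ₐ-cong i (λ a a′ → ∑ₐ-cong j (λ b b′ → x∙yz≈y∙xz (ι (suc b′)) (F a b) (G a′ (suc b′)))))
      ⟩
    ∑ₐ i (λ a a′ → ∑ₐ j (λ b b′ → ∂y F a b * G a′ b′)) +
    ∑ₐ i (λ a a′ → ∑ₐ j (λ b b′ → F a b * ∂y G a′ b′))
      ≡⟨ sym (cong₂ _+_ (⊛-∑ₐ (∂y F) G i j) (⊛-∑ₐ F (∂y G) i j)) ⟩
    ((∂y F ⊛ G) ⊕ (F ⊛ ∂y G)) i j ∎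
    where
    open ≡-Reasoning
    Φ : ℕ → ℕ → ℕ → ℕ → ℚ
    Φ a a′ b b′ = F a b * G a′ b′
    left right : ℕ → ℕ → ℚ
    left  a a′ = ∑ₐ j (λ b b′ → ι (suc b) * Φ a a′ (suc b) b′)
    right a a′ = ∑ₐ j (λ b b′ → ι (suc b′) * Φ a a′ b (suc b′))

  mulX-⊕ : ∀ F G → mulX (F ⊕ G) ≐ mulX F ⊕ mulX G
  mulX-⊕ F G zero    j = refl
  mulX-⊕ F G (suc i) j = refl

  ⊛-mulX : ∀ F G → F ⊛ mulX G ≐ mulX (F ⊛ G)
  ⊛-mulX F G i j = begin
    (F ⊛ mulX G) i j   ≡⟨ ⊛-comm F (mulX G) i j ⟩
    (mulX G ⊛ F) i j   ≡⟨ mulX-⊛ G F i j ⟩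
    mulX (G ⊛ F) i j   ≡⟨ mulX-cong (⊛-comm G F) i j ⟩
    mulX (F ⊛ G) i j   ∎
    where open ≡-Reasoning

  -- D = ∂ₓ − (1 − 2x) ∂_y kills u = y + x − x², as ∂ₓ u = 1 − 2x and ∂_y u = 1.
  D : FPS → FPS
  D F = (∂x F ⊖ ∂y F) ⊕ (ι 2 · mulX (∂y F))

  IsConstant : FPS → Set
  IsConstant F = D F ≐ 𝟘

  D-cong : ∀ {F G} → F ≐ G → D F ≐ D G
  D-cong {F} {G} F≐G i j = cong₂ _+_
    (cong₂ _-_ (cong (ι (suc i) *_) (F≐G (suc i) j)) (cong (ι (suc j) *_) (F≐G i (suc j))))
    (cong (ι 2 *_) (mulX-cong (λ a b → cong (ι (suc b) *_) (F≐G a (suc b))) i j))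

  private
    regroup : ∀ a a′ b b′ c c′ →
      (a + a′) - (b + b′) + ι 2 * (c + c′) ≡ (a - b + ι 2 * c) + (a′ - b′ + ι 2 * c′)
    regroup = solve 6 (λ a a′ b b′ c c′ → (a :+ a′) :- (b :+ b′) :+ con (ι 2) :* (c :+ c′) :=
                                          (a :- b :+ con (ι 2) :* c) :+ (a′ :- b′ :+ con (ι 2) :* c′)) refl

    factor : ∀ r a b c → r * a - r * b + ι 2 * (r * c) ≡ r * (a - b + ι 2 * c)
    factor = solve 4 (λ r a b c → r :* a :- r :* b :+ con (ι 2) :* (r :* c) :=
                                  r :* (a :- b :+ con (ι 2) :* c)) refl

  D-⊕ : ∀ F G → D (F ⊕ G) ≐ D F ⊕ D G
  D-⊕ F G i j = trans
    (cong₂ _+_ (cong₂ _-_ (*-distribˡ-+ (ι (suc i)) (F (suc i) j) (G (suc i) j))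
                          (*-distribˡ-+ (ι (suc j)) (F i (suc j)) (G i (suc j))))
               (cong (ι 2 *_) (trans (mulX-cong (λ a b → *-distribˡ-+ (ι (suc b)) (F a (suc b)) (G a (suc b))) i j)
                                     (mulX-⊕ (∂y F) (∂y G) i j))))
    (regroup (∂x F i j) (∂x G i j) (∂y F i j) (∂y G i j) (mulX (∂y F) i j) (mulX (∂y G) i j))

  D-· : ∀ r F → D (r · F) ≐ r · D F
  D-· r F i j = trans
    (cong₂ _+_ (cong₂ _-_ (x∙yz≈y∙xz (ι (suc i)) r (F (suc i) j)) (x∙yz≈y∙xz (ι (suc j)) r (F i (suc j))))
               (cong (ι 2 *_) (mulX-· i)))
    (factor r (∂x F i j) (∂y F i j) (mulX (∂y F) i j))
    where
    mulX-· : ∀ i → mulX (∂y (r · F)) i j ≡ r * mulX (∂y F) i j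
    mulX-· zero    = sym (*-zeroʳ r)
    mulX-· (suc i) = x∙yz≈y∙xz (ι (suc j)) r (F i (suc j))

  D-⊛ : ∀ F G i j → (D F ⊛ G) i j ≡ (∂x F ⊛ G) i j - (∂y F ⊛ G) i j + ι 2 * (mulX (∂y F) ⊛ G) i j
  D-⊛ F G i j = trans (⊛-distribʳ-⊕ (∂x F ⊖ ∂y F) (ι 2 · mulX (∂y F)) G i j)
    (cong₂ _+_ (⊛-distribʳ-⊖ (∂x F) (∂y F) G i j) (⊛-·ˡ (ι 2) (mulX (∂y F)) G i j))

  D-leibniz : ∀ F G → D (F ⊛ G) ≐ (D F ⊛ G) ⊕ (F ⊛ D G)
  D-leibniz F G i j = begin
    ∂x (F ⊛ G) i j - ∂y (F ⊛ G) i j + ι 2 * mulX (∂y (F ⊛ G)) i j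
      ≡⟨ cong₂ _+_ (cong₂ _-_ (∂x-leibniz F G i j) (∂y-leibniz F G i j)) (cong (ι 2 *_) mulX-term) ⟩
    ((∂x F ⊛ G) i j + (F ⊛ ∂x G) i j) - ((∂y F ⊛ G) i j + (F ⊛ ∂y G) i j) +
    ι 2 * ((mulX (∂y F) ⊛ G) i j + (F ⊛ mulX (∂y G)) i j)
      ≡⟨ regroup ((∂x F ⊛ G) i j) ((F ⊛ ∂x G) i j) ((∂y F ⊛ G) i j) ((F ⊛ ∂y G) i j)
                 ((mulX (∂y F) ⊛ G) i j) ((F ⊛ mulX (∂y G)) i j) ⟩
    ((∂x F ⊛ G) i j - (∂y F ⊛ G) i j + ι 2 * (mulX (∂y F) ⊛ G) i j) +
    ((F ⊛ ∂x G) i j - (F ⊛ ∂y G) i j + ι 2 * (F ⊛ mulX (∂y G)) i j)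
      ≡⟨ sym (cong₂ _+_ (D-⊛ F G i j) (trans (⊛-comm F (D G) i j) (trans (D-⊛ G F i j) swapped))) ⟩
    (D F ⊛ G) i j + (F ⊛ D G) i j ∎
    where
    open ≡-Reasoning
    mulX-term : mulX (∂y (F ⊛ G)) i j ≡ (mulX (∂y F) ⊛ G) i j + (F ⊛ mulX (∂y G)) i j
    mulX-term = begin
      mulX (∂y (F ⊛ G)) i j                           ≡⟨ mulX-cong (∂y-leibniz F G) i j ⟩
      mulX ((∂y F ⊛ G) ⊕ (F ⊛ ∂y G)) i j              ≡⟨ mulX-⊕ (∂y F ⊛ G) (F ⊛ ∂y G) i j ⟩
      mulX (∂y F ⊛ G) i j + mulX (F ⊛ ∂y G) i j
        ≡⟨ sym (cong₂ _+_ (mulX-⊛ (∂y F) G i j) (⊛-mulX F (∂y G) i j)) ⟩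
      (mulX (∂y F) ⊛ G) i j + (F ⊛ mulX (∂y G)) i j   ∎
    swapped : (∂x G ⊛ F) i j - (∂y G ⊛ F) i j + ι 2 * (mulX (∂y G) ⊛ F) i j ≡
              (F ⊛ ∂x G) i j - (F ⊛ ∂y G) i j + ι 2 * (F ⊛ mulX (∂y G)) i j
    swapped = cong₂ _+_ (cong₂ _-_ (⊛-comm (∂x G) F i j) (⊛-comm (∂y G) F i j))
                        (cong (ι 2 *_) (⊛-comm (mulX (∂y G)) F i j))

  constant-cong : ∀ F G → F ≐ G → IsConstant G → IsConstant F
  constant-cong F G F≐G cG i j = trans (D-cong F≐G i j) (cG i j)

  ⊕-constant : ∀ F G → IsConstant F → IsConstant G → IsConstant (F ⊕ G)
  ⊕-constant F G cF cG i j = trans (D-⊕ F G i j) (trans (cong₂ _+_ (cF i j) (cG i j)) (+-identityˡ 0ℚ))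

  ·-constant : ∀ r F → IsConstant F → IsConstant (r · F)
  ·-constant r F cF i j = trans (D-· r F i j) (trans (cong (r *_) (cF i j)) (*-zeroʳ r))

  ⊖-constant : ∀ F G → IsConstant F → IsConstant G → IsConstant (F ⊖ G)
  ⊖-constant F G cF cG = constant-cong (F ⊖ G) (F ⊕ ((- 1ℚ) · G))
    (λ i j → cong (λ g → F i j + g) (sym (-1*x≈-x (G i j))))
    (⊕-constant F ((- 1ℚ) · G) cF (·-constant (- 1ℚ) G cG))

  ⊛-constant : ∀ F G → IsConstant F → IsConstant G → IsConstant (F ⊛ G)
  ⊛-constant F G cF cG i j = begin
    D (F ⊛ G) i j                   ≡⟨ D-leibniz F G i j ⟩
    (D F ⊛ G) i j + (F ⊛ D G) i j   ≡⟨ cong₂ _+_ (⊛-cong {G = G} cF (λ _ _ → refl) i j)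
                                                 (⊛-cong {F = F} (λ _ _ → refl) cG i j) ⟩
    (𝟘 ⊛ G) i j + (F ⊛ 𝟘) i j       ≡⟨ cong₂ _+_ (⊛-zeroˡ G i j)
                                                 (trans (⊛-comm F 𝟘 i j) (⊛-zeroˡ F i j)) ⟩
    0ℚ + 0ℚ                         ≡⟨ +-identityˡ 0ℚ ⟩
    0ℚ                              ∎
    where open ≡-Reasoning

  ∂y-from-D : ∀ F i j → D F i j ≡ 0ℚ → ∂y F i j ≡ ∂x F i j + ι 2 * mulX (∂y F) i j
  ∂y-from-D F i j DF≡0 = begin
    ∂y F i j             ≡⟨ solve 3 (λ a b c → b := (a :+ c) :- (a :- b :+ c)) refl a (∂y F i j) c ⟩
    (a + c) - D F i j    ≡⟨ cong (λ d → (a + c) - d) DF≡0 ⟩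
    (a + c) - 0ℚ         ≡⟨ +-identityʳ (a + c) ⟩
    a + c                ∎
    where
    open ≡-Reasoning
    a = ∂x F i j
    c = ι 2 * mulX (∂y F) i j

  -- D F = 0 expresses the coefficient of xⁱ yʲ⁺¹ through those of xⁱ⁺¹ yʲ and xⁱ⁻¹ yʲ⁺¹.
  constant-unique : ∀ F G → IsConstant F → IsConstant G → (∀ i → F i 0 ≡ G i 0) → F ≐ G
  constant-unique F G cF cG row₀ i zero    = row₀ i
  constant-unique F G cF cG row₀ i (suc j) = column i
    where
    previousColumn : ∀ a → F a j ≡ G a j
    previousColumn a = constant-unique F G cF cG row₀ a j
    step : ∀ i → mulX (∂y F) i j ≡ mulX (∂y G) i j → F i (suc j) ≡ G i (suc j)
    step i below = *-cancelˡ-≡ (ι (suc j)) (begin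
      ∂y F i j                          ≡⟨ ∂y-from-D F i j (cF i j) ⟩
      ∂x F i j + ι 2 * mulX (∂y F) i j
        ≡⟨ cong₂ (λ p q → ι (suc i) * p + ι 2 * q) (previousColumn (suc i)) below ⟩
      ∂x G i j + ι 2 * mulX (∂y G) i j  ≡⟨ sym (∂y-from-D G i j (cG i j)) ⟩
      ∂y G i j                          ∎)
      where open ≡-Reasoning
    column : ∀ i → F i (suc j) ≡ G i (suc j)
    column zero    = step zero refl
    column (suc i) = step (suc i) (cong (ι (suc j) *_) (column i))

  D-vanishing : ∀ F i j →
    F (suc i) j ≡ 0ℚ → F i (suc j) ≡ 0ℚ → mulX F i (suc j) ≡ 0ℚ → D F i j ≡ 0ℚ
  D-vanishing F i j right≡0 up≡0 diagonal≡0 =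
    cong₂ _+_ (cong₂ _-_ (scaled (ι (suc i)) right≡0) (scaled (ι (suc j)) up≡0))
              (scaled (ι 2) (mulX-∂y i diagonal≡0))
    where
    scaled : ∀ r {q} → q ≡ 0ℚ → r * q ≡ 0ℚ
    scaled r refl = *-zeroʳ r
    mulX-∂y : ∀ i → mulX F i (suc j) ≡ 0ℚ → mulX (∂y F) i j ≡ 0ℚ
    mulX-∂y zero    _ = refl
    mulX-∂y (suc i) e = scaled (ι (suc j)) e

  𝟙-constant : IsConstant 𝟙
  𝟙-constant i j = D-vanishing 𝟙 i j refl (above i) (diagonal i)
    where
    above : ∀ i → 𝟙 i (suc j) ≡ 0ℚ
    above zero    = refl
    above (suc i) = refl
    diagonal : ∀ i → mulX 𝟙 i (suc j) ≡ 0ℚ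
    diagonal zero    = refl
    diagonal (suc i) = above i

module Radicand where

  open Rationals
  open FiniteSums
  open PowerSeries
  open Derivation
  open import Data.Nat as ℕ using (zero; suc)
  open import Data.Rational using (_+_; _*_; _-_)
  open import Relation.Binary.PropositionalEquality

  u : FPS
  u = (𝕪 ⊕ 𝕩) ⊖ mulX 𝕩

  radicand≐ : radicand ≐ 𝟙 ⊖ (ι 4 · u)
  radicand≐ i j = cong (λ x² → 𝟙 i j - ι 4 * ((𝕪 i j + 𝕩 i j) - x²)) (𝕩-⊛ 𝕩 i j)

  u-constant : IsConstant u
  u-constant zero                         zero    = refl
  u-constant zero                         (suc j) = D-vanishing u 0 (suc j) refl refl refl
  u-constant (suc zero)                   zero    = refl
  u-constant (suc zero)                   (suc j) = D-vanishing u 1 (suc j) refl refl refl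
  u-constant (suc (suc zero))             j       = D-vanishing u 2 j refl refl refl
  u-constant (suc (suc (suc zero)))       j       = D-vanishing u 3 j refl refl refl
  u-constant (suc (suc (suc (suc i))))    j       = D-vanishing u (4 ℕ.+ i) j refl refl refl

  radicand-constant : IsConstant radicand
  radicand-constant = constant-cong radicand (𝟙 ⊖ (ι 4 · u)) radicand≐
    (⊖-constant 𝟙 (ι 4 · u) 𝟙-constant (·-constant (ι 4) u u-constant))

  u-row₀-partialSums : ∀ i → ∑< (suc i) (λ a → u a 0) ≡ 𝕩 i 0
  u-row₀-partialSums zero          = refl
  u-row₀-partialSums (suc zero)    = refl
  u-row₀-partialSums (suc (suc i)) = cong (λ s → u 0 0 + (u 1 0 + (u 2 0 + s))) (∑<-zero i (λ _ _ → refl))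

module StandardPaths where

  open import Data.Bool using (Bool; true; false; T; not; _∧_; _∨_)
  open import Data.Bool.Properties using (T-irrelevant; T-∧; T-∨; ∧-commutativeMonoid; ∧-assoc; ∧-identityʳ)
  open import Data.Bool.ListAction using (all; any)
  open import Data.Empty using (⊥; ⊥-elim)
  open import Data.Fin using (Fin)
  open import Data.Fin.Properties using (+↔⊎; *↔×; 1↔⊤)
  open import Data.Fin.Permutation using (↔⇒≡)
  open import Data.List using (List; []; _∷_; _++_; [_]; length; upTo; filter)
  open import Data.List.Properties using (filter-++; length-++; ∷-injective)
  open import Data.List.Relation.Unary.Any.Properties using (any⁺; any⁻)
  open import Data.List.Membership.Propositional using (find; lose)
  open import Data.List.Membership.Propositional.Properties using (∈-upTo⁺; ∈-upTo⁻)
  open import Data.Nat using (zero; suc; _+_; _*_; _≡ᵇ_; _≤ᵇ_; _<_; s≤s; z≤n; _≟_)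
  open import Data.Nat.Properties using (≡ᵇ⇒≡; ≡⇒≡ᵇ; +-comm; +-suc; +-identityʳ; 1+n≢n)
  open import Data.Nat.ListAction.Properties using (sum-++)
  open import Data.Product using (∃; proj₁; proj₂)
  open import Data.Product.Function.Dependent.Propositional using (congˡ)
  open import Data.Product.Function.NonDependent.Propositional using (_×-cong_)
  open import Data.Sum using (_⊎_; inj₁; inj₂)
  open import Data.Sum.Function.Propositional using (_⊎-cong_)
  open import Data.Unit using (tt)
  open import Data.Vec using (Vec; []; _∷_; last; init; _∷ʳ_; initLast)
  open import Data.Vec.Properties using (init-∷ʳ; last-∷ʳ)
  open import Function using (_∘_)
  open import Function.Bundles using (_↔_; _⇔_; mk⇔; mk↔ₛ′; mk⤖; Inverse; Equivalence)
  open import Function.Consequences.Propositional using (strictlySurjective⇒surjective)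
  open import Function.Properties.Bijection using (⤖⇒↔)
  open import Function.Properties.Inverse using (↔-refl; ↔-sym; ↔-trans)
  open import Function.Related.TypeIsomorphisms using (Σ-distribˡ-⊎)
  open import Relation.Nullary using (¬_)
  open import Relation.Nullary.Decidable using (toWitness; fromWitness)
  open import Relation.Binary.PropositionalEquality hiding ([_])
  open import Relation.Binary.PropositionalEquality.Properties using (subst-subst-sym; subst-sym-subst)
  open import Algebra.Bundles using (CommutativeMonoid)
  open import Algebra.Properties.CommutativeSemigroup (CommutativeMonoid.commutativeSemigroup ∧-commutativeMonoid)
    using (x∙yz≈y∙xz)

  record Recurrence (c : ℕ → ℕ → ℕ) : Set where
    field
      base  : ∀ i → c i 0 ≡ 1
      step₀ : ∀ j → c 0 (suc j) ≡ c 1 j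
      step  : ∀ i j → c (suc i) (suc j) ≡ c i (suc j) + (c i (suc j) + suc (suc i) * c (suc (suc i)) j)

  Shape : ℕ → ℕ → List ℕ → Set
  Shape i j P = T (finalShape i j P)

  count-snoc : ∀ a x P → count a (P ++ [ x ]) ≡ count a (x ∷ P)
  count-snoc a x P = begin
    length (filter (_≟ a) (P ++ [ x ]))               ≡⟨ cong length (filter-++ (_≟ a) P [ x ]) ⟩
    length (filter (_≟ a) P ++ filter (_≟ a) [ x ])   ≡⟨ length-++ (filter (_≟ a) P) ⟩
    count a P + count a [ x ]                         ≡⟨ +-comm (count a P) (count a [ x ]) ⟩
    count a [ x ] + count a P                         ≡⟨ sym (length-++ (filter (_≟ a) [ x ])) ⟩
    length (filter (_≟ a) [ x ] ++ filter (_≟ a) P)   ≡⟨ cong length (sym (filter-++ (_≟ a) [ x ] P)) ⟩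
    count a (x ∷ P)                                   ∎
    where open ≡-Reasoning

  all-snoc : ∀ (f : ℕ → Bool) x P → all f (P ++ [ x ]) ≡ all f (x ∷ P)
  all-snoc f x []      = refl
  all-snoc f x (p ∷ P) = trans (cong (f p ∧_) (all-snoc f x P)) (x∙yz≈y∙xz (f p) (f x) (all f P))

  onesAndTwos : List ℕ → Bool
  onesAndTwos = all (λ p → (p ≡ᵇ 1) ∨ (p ≡ᵇ 2))

  finalShape-snoc : ∀ i j P → finalShape i j (P ++ [ 1 ]) ≡ finalShape i j (1 ∷ P)
  finalShape-snoc i j P
    rewrite count-snoc 1 1 P | count-snoc 2 1 P | all-snoc (λ p → (p ≡ᵇ 1) ∨ (p ≡ᵇ 2)) 1 P = refl

  Shape⇒counts : ∀ i j P → Shape i j P → count 1 P ≡ i × count 2 P ≡ j × T (onesAndTwos P)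
  Shape⇒counts i j P s with count 1 P ≡ᵇ i in e₁ | count 2 P ≡ᵇ j in e₂
  ... | true | true = ≡ᵇ⇒≡ _ _ (subst T (sym e₁) tt) , ≡ᵇ⇒≡ _ _ (subst T (sym e₂) tt) , s

  isOneAt : ℕ → List ℕ → Bool
  isOneAt k       []      = false
  isOneAt zero    (p ∷ P) = p ≡ᵇ 1
  isOneAt (suc k) (p ∷ P) = isOneAt k P

  isOneAt⇒< : ∀ k P → T (isOneAt k P) → k < length P
  isOneAt⇒< zero    (p ∷ P) _   = s≤s z≤n
  isOneAt⇒< (suc k) (p ∷ P) one = s≤s (isOneAt⇒< k P one)

  count₁-incAt : ∀ k P → T (isOneAt k P) → count 1 P ≡ suc (count 1 (incAt k P))
  count₁-incAt zero    (suc zero ∷ P)          _   = refl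
  count₁-incAt (suc k) (zero ∷ P)              one = count₁-incAt k P one
  count₁-incAt (suc k) (suc zero ∷ P)          one = cong suc (count₁-incAt k P one)
  count₁-incAt (suc k) (suc (suc p) ∷ P)       one = count₁-incAt k P one

  count₂-incAt : ∀ k P → T (isOneAt k P) → count 2 (incAt k P) ≡ suc (count 2 P)
  count₂-incAt zero    (suc zero ∷ P)          _   = refl
  count₂-incAt (suc k) (zero ∷ P)              one = count₂-incAt k P one
  count₂-incAt (suc k) (suc zero ∷ P)          one = count₂-incAt k P one
  count₂-incAt (suc k) (suc (suc zero) ∷ P)    one = cong suc (count₂-incAt k P one)
  count₂-incAt (suc k) (suc (suc (suc p)) ∷ P) one = count₂-incAt k P one

  onesAndTwos-incAt : ∀ k P → T (isOneAt k P) → onesAndTwos (incAt k P) ≡ onesAndTwos P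
  onesAndTwos-incAt zero    (suc zero ∷ P)          _   = refl
  onesAndTwos-incAt (suc k) (zero ∷ P)              one = refl
  onesAndTwos-incAt (suc k) (suc zero ∷ P)          one = onesAndTwos-incAt k P one
  onesAndTwos-incAt (suc k) (suc (suc zero) ∷ P)    one = onesAndTwos-incAt k P one
  onesAndTwos-incAt (suc k) (suc (suc (suc p)) ∷ P) one = refl

  finalShape-incAt : ∀ i j k P → T (isOneAt k P) → finalShape i (suc j) (incAt k P) ≡ finalShape (suc i) j P
  finalShape-incAt i j k P one rewrite count₁-incAt k P one | count₂-incAt k P one | onesAndTwos-incAt k P one = refl

  ¬Shape-incAt : ∀ i k P → T (isOneAt k P) → ¬ Shape i 0 (incAt k P)
  ¬Shape-incAt i k P one s
    with () ← trans (sym (count₂-incAt k P one)) (proj₁ (proj₂ (Shape⇒counts i 0 (incAt k P) s)))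

  onesAndTwos-incAt⇒isOneAt : ∀ k P → T (isComposition P) → k < length P →
    T (onesAndTwos (incAt k P)) → T (isOneAt k P)
  onesAndTwos-incAt⇒isOneAt zero    (suc zero ∷ P) _    _         _    = tt
  onesAndTwos-incAt⇒isOneAt (suc k) (suc p ∷ P)    comp (s≤s k<n) only =
    onesAndTwos-incAt⇒isOneAt k P comp k<n (proj₂ (Equivalence.to T-∧ only))

  allOnes : List ℕ → Bool
  allOnes = all (_≡ᵇ 1)

  allOnes⇒count₂≡0 : ∀ P → T (allOnes P) → count 2 P ≡ 0
  allOnes⇒count₂≡0 []             _    = refl
  allOnes⇒count₂≡0 (suc zero ∷ P) ones = allOnes⇒count₂≡0 P ones

  count₂≡0⇒allOnes : ∀ P → T (onesAndTwos P) → count 2 P ≡ 0 → T (allOnes P)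
  count₂≡0⇒allOnes []                   _    _  = tt
  count₂≡0⇒allOnes (suc zero ∷ P)       only c₂ = count₂≡0⇒allOnes P only c₂
  count₂≡0⇒allOnes (suc (suc zero) ∷ P) _    ()

  allOnes⇒snoc≡cons : ∀ P → T (allOnes P) → P ++ [ 1 ] ≡ 1 ∷ P
  allOnes⇒snoc≡cons []             _    = refl
  allOnes⇒snoc≡cons (suc zero ∷ P) ones = cong (1 ∷_) (allOnes⇒snoc≡cons P ones)

  snoc≡cons⇒allOnes : ∀ P → P ++ [ 1 ] ≡ 1 ∷ P → T (allOnes P)
  snoc≡cons⇒allOnes []           _  = tt
  snoc≡cons⇒allOnes (p ∷ P) e with ∷-injective e
  ... | refl , e′ = snoc≡cons⇒allOnes P e′

  Covering : List ℕ → List ℕ → Set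
  Covering Q P = Q ≡ 1 ∷ P ⊎ Q ≡ P ++ [ 1 ] ⊎ ∃ λ k → k < length P × Q ≡ incAt k P

  covers⇔ : ∀ Q P → T (covers Q P) ⇔ Covering Q P
  covers⇔ Q P = mk⇔ cases uncases
    where
    cons snoc inc : Bool
    cons = Q =ᶜ (1 ∷ P)
    snoc = Q =ᶜ (P ++ [ 1 ])
    inc  = any (λ k → Q =ᶜ incAt k P) (upTo (length P))
    cases : T (covers Q P) → Covering Q P
    cases cov with Equivalence.to (T-∨ {cons} {snoc ∨ inc}) cov
    ... | inj₁ Q≡ = inj₁ (toWitness Q≡)
    ... | inj₂ rest with Equivalence.to (T-∨ {snoc} {inc}) rest
    ...   | inj₁ Q≡ = inj₂ (inj₁ (toWitness Q≡))
    ...   | inj₂ Q≡ with find (any⁻ (λ k → Q =ᶜ incAt k P) (upTo (length P)) Q≡)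
    ...     | k , k∈ , Q≡incAt = inj₂ (inj₂ (k , ∈-upTo⁻ k∈ , toWitness Q≡incAt))
    uncases : Covering Q P → T (covers Q P)
    uncases (inj₁ Q≡) = Equivalence.from (T-∨ {cons} {snoc ∨ inc}) (inj₁ (fromWitness Q≡))
    uncases (inj₂ Q≡) =
      Equivalence.from (T-∨ {cons} {snoc ∨ inc}) (inj₂ (Equivalence.from (T-∨ {snoc} {inc}) (later Q≡)))
      where
      later : Q ≡ P ++ [ 1 ] ⊎ ∃ (λ k → k < length P × Q ≡ incAt k P) → T snoc ⊎ T inc
      later (inj₁ Q≡)             = inj₁ (fromWitness Q≡)
      later (inj₂ (k , k<n , Q≡)) = inj₂ (any⁺ (λ k → Q =ᶜ incAt k P) (lose (∈-upTo⁺ k<n) (fromWitness Q≡)))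

  length-incAt : ∀ k P → length (incAt k P) ≡ length P
  length-incAt k       []      = refl
  length-incAt zero    (p ∷ P) = refl
  length-incAt (suc k) (p ∷ P) = cong suc (length-incAt k P)

  incAt-injective : ∀ {k k′} P → k < length P → k′ < length P → incAt k P ≡ incAt k′ P → k ≡ k′
  incAt-injective {zero}  {zero}   (p ∷ P) _         _          _  = refl
  incAt-injective {zero}  {suc k′} (p ∷ P) _         _          e  = ⊥-elim (1+n≢n (proj₁ (∷-injective e)))
  incAt-injective {suc k} {zero}   (p ∷ P) _         _          e  = ⊥-elim (1+n≢n (sym (proj₁ (∷-injective e))))
  incAt-injective {suc k} {suc k′} (p ∷ P) (s≤s k<n) (s≤s k′<n) e  =
    cong suc (incAt-injective P k<n k′<n (proj₂ (∷-injective e)))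

  incAt≢cons : ∀ k P → incAt k P ≢ 1 ∷ P
  incAt≢cons k P e = 1+n≢n (sym (trans (sym (length-incAt k P)) (cong length e)))

  incAt≢snoc : ∀ k P → incAt k P ≢ P ++ [ 1 ]
  incAt≢snoc k P e = 1+n≢n (sym (begin
    length P               ≡⟨ sym (length-incAt k P) ⟩
    length (incAt k P)     ≡⟨ cong length e ⟩
    length (P ++ [ 1 ])    ≡⟨ length-++ P ⟩
    length P + 1           ≡⟨ +-comm (length P) 1 ⟩
    suc (length P)         ∎))
    where open ≡-Reasoning

  isComposition-incAt : ∀ k P → T (isComposition P) → T (isComposition (incAt k P))
  isComposition-incAt k       []          _    = tt
  isComposition-incAt zero    (suc p ∷ P) comp = comp
  isComposition-incAt (suc k) (suc p ∷ P) comp = isComposition-incAt k P comp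

  weight-incAt : ∀ k P → k < length P → weight (incAt k P) ≡ suc (weight P)
  weight-incAt zero    (p ∷ P) _         = refl
  weight-incAt (suc k) (p ∷ P) (s≤s k<n) = trans (cong (λ w → p + w) (weight-incAt k P k<n)) (+-suc p (weight P))

  covers-step : ∀ Q P → T (covers Q P) → T (isComposition P) → T (isComposition Q) × weight Q ≡ suc (weight P)
  covers-step Q P cov comp with Equivalence.to (covers⇔ Q P) cov
  ... | inj₁ refl                  = comp , refl
  ... | inj₂ (inj₁ refl)           = subst T (sym (all-snoc (1 ≤ᵇ_) 1 P)) comp ,
                                     trans (sum-++ P [ 1 ]) (+-comm (weight P) 1)
  ... | inj₂ (inj₂ (k , k<n , refl)) = isComposition-incAt k P comp , weight-incAt k P k<n

  Successors : ℕ → ℕ → List ℕ → Set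
  Successors i j P = Σ (List ℕ) λ Q → T (covers Q P) × Shape i j Q

  -- (P, 1) is a successor different from (1, P) exactly when P is not all ones.
  Prepended Appended Raised : ℕ → ℕ → List ℕ → Set
  Prepended i j P = Shape i j (1 ∷ P)
  Appended  i j P = Shape i j (P ++ [ 1 ]) × T (not (allOnes P))
  Raised    i j P = Σ ℕ λ k → T (isOneAt k P) × Shape i j (incAt k P)

  successor : ∀ {i j} P → Prepended i j P ⊎ Appended i j P ⊎ Raised i j P → Successors i j P
  successor P (inj₁ s) =
    1 ∷ P , Equivalence.from (covers⇔ (1 ∷ P) P) (inj₁ refl) , s
  successor P (inj₂ (inj₁ (s , _))) =
    P ++ [ 1 ] , Equivalence.from (covers⇔ (P ++ [ 1 ]) P) (inj₂ (inj₁ refl)) , s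
  successor P (inj₂ (inj₂ (k , one , s))) =
    incAt k P , Equivalence.from (covers⇔ (incAt k P) P) (inj₂ (inj₂ (k , isOneAt⇒< k P one , refl))) , s

  Successors-≡ : ∀ {i j P} {x y : Successors i j P} → proj₁ x ≡ proj₁ y → x ≡ y
  Successors-≡ {x = Q , cov , s} {.Q , cov′ , s′} refl =
    cong₂ (λ c t → Q , c , t) (T-irrelevant cov cov′) (T-irrelevant s s′)

  successor-injective : ∀ {i j} P {x y : Prepended i j P ⊎ Appended i j P ⊎ Raised i j P} →
    successor P x ≡ successor P y → x ≡ y
  successor-injective P e = injective (cong proj₁ e)
    where
    contradictory : ∀ {b} → T b → T (not b) → ⊥
    contradictory {true} _ ()
    injective : ∀ {x y} → proj₁ (successor P x) ≡ proj₁ (successor P y) → x ≡ y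
    injective {inj₁ s}                    {inj₁ s′}                     _  = cong inj₁ (T-irrelevant s s′)
    injective {inj₁ _}                    {inj₂ (inj₁ (_ , notOnes))}   Q≡ =
      ⊥-elim (contradictory (snoc≡cons⇒allOnes P (sym Q≡)) notOnes)
    injective {inj₁ _}                    {inj₂ (inj₂ (k , _))}         Q≡ = ⊥-elim (incAt≢cons k P (sym Q≡))
    injective {inj₂ (inj₁ (_ , notOnes))} {inj₁ _}                      Q≡ =
      ⊥-elim (contradictory (snoc≡cons⇒allOnes P Q≡) notOnes)
    injective {inj₂ (inj₁ (s , n))}       {inj₂ (inj₁ (s′ , n′))}       _  =
      cong (inj₂ ∘ inj₁) (cong₂ _,_ (T-irrelevant s s′) (T-irrelevant n n′))
    injective {inj₂ (inj₁ _)}             {inj₂ (inj₂ (k , _))}         Q≡ = ⊥-elim (incAt≢snoc k P (sym Q≡))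
    injective {inj₂ (inj₂ (k , _))}       {inj₁ _}                      Q≡ = ⊥-elim (incAt≢cons k P Q≡)
    injective {inj₂ (inj₂ (k , _))}       {inj₂ (inj₁ _)}               Q≡ = ⊥-elim (incAt≢snoc k P Q≡)
    injective {inj₂ (inj₂ (k , one , s))} {inj₂ (inj₂ (k′ , one′ , s′))} Q≡
      with refl ← incAt-injective P (isOneAt⇒< k P one) (isOneAt⇒< k′ P one′) Q≡ =
      cong (λ (o , t) → inj₂ (inj₂ (k , o , t))) (cong₂ _,_ (T-irrelevant one one′) (T-irrelevant s s′))

  successor-surjective : ∀ {i j} P → T (isComposition P) → ∀ y → ∃ λ x → successor {i} {j} P x ≡ y
  successor-surjective {i} {j} P comp (Q , cov , s) with Equivalence.to (covers⇔ Q P) cov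
  ... | inj₁ refl = inj₁ s , Successors-≡ refl
  ... | inj₂ (inj₂ (k , k<n , refl)) =
    inj₂ (inj₂ (k , onesAndTwos-incAt⇒isOneAt k P comp k<n (proj₂ (proj₂ (Shape⇒counts i j (incAt k P) s))) , s)) ,
    Successors-≡ refl
  ... | inj₂ (inj₁ refl) = appended (allOnes P) refl
    where
    appended : ∀ b → allOnes P ≡ b → ∃ λ x → successor P x ≡ (P ++ [ 1 ] , cov , s)
    appended true  ones = inj₁ (subst (Shape i j) snoc≡cons s) , Successors-≡ (sym snoc≡cons)
      where snoc≡cons = allOnes⇒snoc≡cons P (subst T (sym ones) tt)
    appended false ones = inj₂ (inj₁ (s , subst (T ∘ not) (sym ones) tt)) , Successors-≡ refl

  successor-cases : ∀ {i j} P → T (isComposition P) →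
    (Prepended i j P ⊎ Appended i j P ⊎ Raised i j P) ↔ Successors i j P
  successor-cases P comp =
    ⤖⇒↔ (mk⤖ (successor-injective P , strictlySurjective⇒surjective (successor-surjective P comp)))

  weightsOK-∷ʳ : ∀ {m} k (Ps : Vec (List ℕ) m) Q →
    weightsOK k (Ps ∷ʳ Q) ≡ weightsOK k Ps ∧ weightsOK (m + k) (Q ∷ [])
  weightsOK-∷ʳ k []       Q = refl
  weightsOK-∷ʳ {suc m} k (P ∷ Ps) Q = begin
    a ∧ b ∧ weightsOK (suc k) (Ps ∷ʳ Q)       ≡⟨ cong (λ r → a ∧ b ∧ r) (weightsOK-∷ʳ (suc k) Ps Q) ⟩
    a ∧ b ∧ c ∧ weightsOK (m + suc k) [Q]     ≡⟨ cong (λ n → a ∧ b ∧ c ∧ weightsOK n [Q]) (+-suc m k) ⟩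
    a ∧ b ∧ c ∧ weightsOK (suc m + k) [Q]     ≡⟨ cong (a ∧_) (sym (∧-assoc b c _)) ⟩
    a ∧ (b ∧ c) ∧ weightsOK (suc m + k) [Q]   ≡⟨ sym (∧-assoc a (b ∧ c) _) ⟩
    (a ∧ b ∧ c) ∧ weightsOK (suc m + k) [Q]   ∎
    where
    open ≡-Reasoning
    a = isComposition P
    b = weight P ≡ᵇ k
    c = weightsOK (suc k) Ps
    [Q] = Q ∷ []

  coverChain-∷ʳ : ∀ {m} P (Rs : Vec (List ℕ) m) Q →
    coverChain P (Rs ∷ʳ Q) ≡ coverChain P Rs ∧ covers Q (last (P ∷ Rs))
  coverChain-∷ʳ P []       Q = ∧-identityʳ (covers Q P)
  coverChain-∷ʳ P (R ∷ Rs) Q rewrite coverChain-∷ʳ R Rs Q = sym (∧-assoc (covers R P) _ _)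

  weightsOK-last : ∀ {m} k (Ps : Vec (List ℕ) (suc m)) → T (weightsOK k Ps) →
    T (isComposition (last Ps)) × weight (last Ps) ≡ m + k
  weightsOK-last k (P ∷ []) ok
    with comp , ok′ ← Equivalence.to T-∧ ok = comp , ≡ᵇ⇒≡ _ _ (proj₁ (Equivalence.to T-∧ ok′))
  weightsOK-last {suc m} k (P ∷ P′ ∷ Ps) ok
    with _ , ok′ ← Equivalence.to (T-∧ {isComposition P}) ok
    with _ , ok″ ← Equivalence.to (T-∧ {weight P ≡ᵇ k}) ok′
    with comp , w ← weightsOK-last (suc k) (P′ ∷ Ps) ok″ = comp , trans w (+-suc m k)

  standardPath-last : ∀ {n} (Ps : Vec (List ℕ) (suc n)) → T (isStandardPath Ps) →
    T (isComposition (last Ps)) × weight (last Ps) ≡ n + 0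
  standardPath-last (P₀ ∷ Rs) sp =
    weightsOK-last 0 (P₀ ∷ Rs) (proj₁ (Equivalence.to (T-∧ {weightsOK 0 (P₀ ∷ Rs)}) sp))

  isStandardPath-∷ʳ : ∀ {n} (Ps : Vec (List ℕ) (suc n)) Q →
    T (isStandardPath (Ps ∷ʳ Q)) ⇔ (T (isStandardPath Ps) × T (covers Q (last Ps)))
  isStandardPath-∷ʳ {n} (P₀ ∷ Rs) Q = mk⇔ split join
    where
    weights chain : Bool
    weights = weightsOK 0 (P₀ ∷ Rs)
    chain = coverChain P₀ Rs
    unfold : isStandardPath ((P₀ ∷ Rs) ∷ʳ Q) ≡
             (weights ∧ weightsOK (suc n + 0) (Q ∷ [])) ∧ (chain ∧ covers Q (last (P₀ ∷ Rs)))
    unfold = cong₂ _∧_ (weightsOK-∷ʳ 0 (P₀ ∷ Rs) Q) (coverChain-∷ʳ P₀ Rs Q)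
    split : T (isStandardPath ((P₀ ∷ Rs) ∷ʳ Q)) → T (isStandardPath (P₀ ∷ Rs)) × T (covers Q (last (P₀ ∷ Rs)))
    split sp with ws , cs ← Equivalence.to T-∧ (subst T unfold sp)
             with w , _ ← Equivalence.to (T-∧ {weights}) ws
             with c , cov ← Equivalence.to (T-∧ {chain}) cs = Equivalence.from T-∧ (w , c) , cov
    join : T (isStandardPath (P₀ ∷ Rs)) × T (covers Q (last (P₀ ∷ Rs))) → T (isStandardPath ((P₀ ∷ Rs) ∷ʳ Q))
    join (sp , cov) with w , c ← Equivalence.to (T-∧ {weights}) sp
                    with compLast , weightLast ← standardPath-last (P₀ ∷ Rs) sp
                    with compQ , weightQ ← covers-step Q (last (P₀ ∷ Rs)) cov compLast =
      subst T (sym unfold) (Equivalence.from T-∧ (Equivalence.from T-∧ (w , lastOK) , Equivalence.from T-∧ (c , cov)))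
      where
      lastOK : T (weightsOK (suc n + 0) (Q ∷ []))
      lastOK = Equivalence.from T-∧
        (compQ , Equivalence.from T-∧ (≡⇒≡ᵇ _ _ (trans weightQ (cong suc weightLast)) , tt))

  isStandardPath-singleton : ∀ P₀ → T (isStandardPath (P₀ ∷ [])) → P₀ ≡ []
  isStandardPath-singleton []          _ = refl
  isStandardPath-singleton (suc p ∷ P) sp with () ← proj₂ (standardPath-last ((suc p ∷ P) ∷ []) sp)

  Path : ℕ → Set
  Path n = Σ (Vec (List ℕ) (suc n)) (T ∘ isStandardPath)

  end : ∀ {n} → Path n → List ℕ
  end (Ps , _) = last Ps

  end-isComposition : ∀ {n} (p : Path n) → T (isComposition (end p))
  end-isComposition (Ps , sp) = proj₁ (standardPath-last Ps sp)

  PathsTo : (List ℕ → Set) → Set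
  PathsTo W = Σ (Σ ℕ Path) (λ p → W (end (proj₂ p)))

  PathsTo-≡ : ∀ {i j n} {Ps Ps′ : Vec (List ℕ) (suc n)} {sp sp′ s s′} → Ps ≡ Ps′ →
    _≡_ {A = PathsTo (Shape i j)} ((n , Ps , sp) , s) ((n , Ps′ , sp′) , s′)
  PathsTo-≡ {n = n} {Ps} refl = cong₂ (λ sp s → (n , Ps , sp) , s) (T-irrelevant _ _) (T-irrelevant _ _)

  PathsC2↔PathsTo : ∀ i j → PathsC2 i j ↔ PathsTo (Shape i j)
  PathsC2↔PathsTo i j =
    mk↔ₛ′ to from (λ _ → PathsTo-≡ refl) (λ (n , Ps , t) → cong (λ t → n , Ps , t) (T-irrelevant _ t))
    where
    to : PathsC2 i j → PathsTo (Shape i j)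
    to (n , Ps , t) with sp , s ← Equivalence.to T-∧ t = (n , Ps , sp) , s
    from : PathsTo (Shape i j) → PathsC2 i j
    from ((n , Ps , sp) , s) = n , Ps , Equivalence.from T-∧ (sp , s)

  PathsTo-Successors-≡ : ∀ {i j n} {Ps Ps′ : Vec (List ℕ) (suc n)} {sp sp′ Q Q′ cov cov′ s s′} →
    Ps ≡ Ps′ → Q ≡ Q′ →
    _≡_ {A = PathsTo (Successors i j)} ((n , Ps , sp) , Q , cov , s) ((n , Ps′ , sp′) , Q′ , cov′ , s′)
  PathsTo-Successors-≡ {n = n} {Ps} {Q = Q} refl refl =
    cong₂ (λ sp (cov , s) → (n , Ps , sp) , Q , cov , s)
          (T-irrelevant _ _) (cong₂ _,_ (T-irrelevant _ _) (T-irrelevant _ _))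

  init∷ʳlast : ∀ {n} (Ps : Vec (List ℕ) (suc n)) → Ps ≡ init Ps ∷ʳ last Ps
  init∷ʳlast Ps = proj₂ (proj₂ (initLast Ps))

  PathsTo-Shape-∷ʳ : ∀ i j → PathsTo (Shape i j) ↔ (Shape i j [] ⊎ PathsTo (Successors i j))
  PathsTo-Shape-∷ʳ i j = mk↔ₛ′ to from to∘from from∘to
    where
    to : PathsTo (Shape i j) → Shape i j [] ⊎ PathsTo (Successors i j)
    to ((zero  , P₀ ∷ [] , sp) , s) = inj₁ (subst (Shape i j) (isStandardPath-singleton P₀ sp) s)
    to ((suc n , Ps , sp) , s)
      with sp′ , cov ← Equivalence.to (isStandardPath-∷ʳ (init Ps) (last Ps))
                                      (subst (T ∘ isStandardPath) (init∷ʳlast Ps) sp)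
      = inj₂ ((n , init Ps , sp′) , last Ps , cov , s)
    from : Shape i j [] ⊎ PathsTo (Successors i j) → PathsTo (Shape i j)
    from (inj₁ s) = (0 , [] ∷ [] , tt) , s
    from (inj₂ ((n , Ps , sp) , Q , cov , s)) =
      (suc n , Ps ∷ʳ Q , Equivalence.from (isStandardPath-∷ʳ Ps Q) (sp , cov)) ,
      subst (Shape i j) (sym (last-∷ʳ Q Ps)) s
    to∘from : ∀ x → to (from x) ≡ x
    to∘from (inj₁ s) = cong inj₁ (T-irrelevant _ _)
    to∘from (inj₂ ((n , Ps , sp) , Q , cov , s)) = cong inj₂ (PathsTo-Successors-≡ (init-∷ʳ Q Ps) (last-∷ʳ Q Ps))
    from∘to : ∀ x → from (to x) ≡ x
    from∘to ((zero  , P₀ ∷ [] , sp) , s) = PathsTo-≡ (cong (_∷ []) (sym (isStandardPath-singleton P₀ sp)))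
    from∘to ((suc n , Ps , sp) , s) = PathsTo-≡ (sym (init∷ʳlast Ps))

  PathsTo-cong : ∀ {W W′ : List ℕ → Set} → (∀ {n} (p : Path n) → W (end p) ↔ W′ (end p)) →
    PathsTo W ↔ PathsTo W′
  PathsTo-cong W↔W′ = congˡ (λ {p} → W↔W′ (proj₂ p))

  empty : ∀ {A : Set} → ¬ A → A ↔ Fin 0
  empty ¬a = mk↔ₛ′ (λ a → ⊥-elim (¬a a)) (λ ()) (λ ()) (λ a → ⊥-elim (¬a a))

  PathsTo-empty : ∀ {W : List ℕ → Set} → (∀ P → ¬ W P) → PathsTo W ↔ Fin 0
  PathsTo-empty ¬W = empty (λ (p , w) → ¬W (end (proj₂ p)) w)

  PathsTo-Shape-cases : ∀ i j → PathsTo (Shape i j) ↔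
    (Shape i j [] ⊎ PathsTo (Prepended i j) ⊎ PathsTo (Appended i j) ⊎ PathsTo (Raised i j))
  PathsTo-Shape-cases i j = ↔-trans (PathsTo-Shape-∷ʳ i j) (↔-refl ⊎-cong ↔-trans
    (PathsTo-cong {Successors i j} {λ P → Prepended i j P ⊎ Appended i j P ⊎ Raised i j P}
      (λ p → ↔-sym (successor-cases (end p) (end-isComposition p))))
    (↔-trans Σ-distribˡ-⊎ (↔-refl ⊎-cong Σ-distribˡ-⊎)))

  OnePositions : List ℕ → Set
  OnePositions P = Σ ℕ λ k → T (isOneAt k P)

  onePositions-∷ : ∀ {n m} p P → (T (p ≡ᵇ 1) ↔ Fin n) → (OnePositions P ↔ Fin m) →
    OnePositions (p ∷ P) ↔ Fin (n + m)
  onePositions-∷ p P head↔ tail↔ = ↔-trans split (↔-trans (head↔ ⊎-cong tail↔) (↔-sym +↔⊎))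
    where
    split : OnePositions (p ∷ P) ↔ (T (p ≡ᵇ 1) ⊎ OnePositions P)
    split = mk↔ₛ′ (λ { (zero , one) → inj₁ one ; (suc k , one) → inj₂ (k , one) })
                  (λ { (inj₁ one) → zero , one ; (inj₂ (k , one)) → suc k , one })
                  (λ { (inj₁ _) → refl ; (inj₂ _) → refl })
                  (λ { (zero , _) → refl ; (suc _ , _) → refl })

  onePositions↔ : ∀ P → OnePositions P ↔ Fin (count 1 P)
  onePositions↔ []                = empty (λ ())
  onePositions↔ (zero ∷ P)        = onePositions-∷ 0 P (empty (λ ())) (onePositions↔ P)
  onePositions↔ (suc zero ∷ P)    = onePositions-∷ 1 P (↔-sym 1↔⊤) (onePositions↔ P)
  onePositions↔ (suc (suc p) ∷ P) = onePositions-∷ (suc (suc p)) P (empty (λ ())) (onePositions↔ P)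

  appended↔ : ∀ i j P → Appended (suc i) (suc j) P ↔ Shape i (suc j) P
  appended↔ i j P = mk↔ₛ′ to from (λ _ → T-irrelevant _ _) (λ _ → cong₂ _,_ (T-irrelevant _ _) (T-irrelevant _ _))
    where
    to : Appended (suc i) (suc j) P → Shape i (suc j) P
    to (s , _) = subst T (finalShape-snoc (suc i) (suc j) P) s
    notAllOnes : count 2 P ≡ suc j → T (not (allOnes P))
    notAllOnes c₂ with allOnes P in ones
    ... | true  with () ← trans (sym c₂) (allOnes⇒count₂≡0 P (subst T (sym ones) tt))
    ... | false = tt
    from : Shape i (suc j) P → Appended (suc i) (suc j) P
    from s = subst T (sym (finalShape-snoc (suc i) (suc j) P)) s ,
             notAllOnes (proj₁ (proj₂ (Shape⇒counts i (suc j) P s)))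

  appended-none₀ : ∀ j P → ¬ Appended 0 j P
  appended-none₀ j P (s , _) = subst T (finalShape-snoc 0 j P) s

  appended-none : ∀ i P → ¬ Appended (suc i) 0 P
  appended-none i P (s , notOnes) with _ , c₂ , only ← Shape⇒counts i 0 P (subst T (finalShape-snoc (suc i) 0 P) s)
    = subst (T ∘ not) (T⇒≡true (count₂≡0⇒allOnes P only c₂)) notOnes
    where
    T⇒≡true : ∀ {b} → T b → b ≡ true
    T⇒≡true {true} _ = refl

  raised-none : ∀ i P → ¬ Raised i 0 P
  raised-none i P (k , one , s) = ¬Shape-incAt i k P one s

  raised↔ : ∀ i j P → Raised i (suc j) P ↔ (Fin (suc i) × Shape (suc i) j P)
  raised↔ i j P = ↔-trans positions (mk↔ₛ′ to from to∘from from∘to)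
    where
    positions : Raised i (suc j) P ↔ (OnePositions P × Shape (suc i) j P)
    positions = mk↔ₛ′ (λ (k , one , s) → (k , one) , subst T (finalShape-incAt i j k P one) s)
                      (λ ((k , one) , s) → k , one , subst T (sym (finalShape-incAt i j k P one)) s)
                      (λ _ → cong (_ ,_) (T-irrelevant _ _))
                      (λ _ → cong (λ s → _ , _ , s) (T-irrelevant _ _))
    open Inverse (onePositions↔ P) using (strictlyInverseˡ; strictlyInverseʳ)
    ones : Shape (suc i) j P → count 1 P ≡ suc i
    ones s = proj₁ (Shape⇒counts (suc i) j P s)
    to : OnePositions P × Shape (suc i) j P → Fin (suc i) × Shape (suc i) j P
    to (pos , s) = subst Fin (ones s) (Inverse.to (onePositions↔ P) pos) , s
    from : Fin (suc i) × Shape (suc i) j P → OnePositions P × Shape (suc i) j P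
    from (f , s) = Inverse.from (onePositions↔ P) (subst Fin (sym (ones s)) f) , s
    to∘from : ∀ x → to (from x) ≡ x
    to∘from (f , s) = cong (_, s) (trans (cong (subst Fin (ones s)) (strictlyInverseˡ _)) (subst-subst-sym (ones s)))
    from∘to : ∀ x → from (to x) ≡ x
    from∘to (pos , s) =
      cong (_, s) (trans (cong (Inverse.from (onePositions↔ P)) (subst-sym-subst (ones s))) (strictlyInverseʳ pos))

  recurrence : ∀ c → Counts c → Recurrence c
  recurrence c counts = record { base = base ; step₀ = step₀ ; step = step }
    where
    paths : ∀ i j → PathsTo (Shape i j) ↔ Fin (c i j)
    paths i j = ↔-sym (↔-trans (counts i j) (PathsC2↔PathsTo i j))

    appended : ∀ i j → PathsTo (Appended (suc i) (suc j)) ↔ Fin (c i (suc j))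
    appended i j = ↔-trans (PathsTo-cong {Appended (suc i) (suc j)} {Shape i (suc j)} (λ p → appended↔ i j (end p)))
                           (paths i (suc j))

    raised : ∀ i j → PathsTo (Raised i (suc j)) ↔ Fin (suc i * c (suc i) j)
    raised i j = ↔-trans
      (PathsTo-cong {Raised i (suc j)} {λ P → Fin (suc i) × Shape (suc i) j P} (λ p → raised↔ i j (end p)))
      (↔-trans (mk↔ₛ′ (λ (p , f , s) → f , p , s) (λ (f , p , s) → p , f , s) (λ _ → refl) (λ _ → refl))
               (↔-trans (↔-refl ×-cong paths (suc i) j) (↔-sym *↔×)))

    size : ∀ {i j a b d e} → Shape i j [] ↔ Fin a → PathsTo (Prepended i j) ↔ Fin b →
           PathsTo (Appended i j) ↔ Fin d → PathsTo (Raised i j) ↔ Fin e → c i j ≡ a + (b + (d + e))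
    size trivial prepended appended raised = ↔⇒≡ (↔-trans (↔-sym (paths _ _)) (↔-trans (PathsTo-Shape-cases _ _)
      (↔-trans (trivial ⊎-cong prepended ⊎-cong appended ⊎-cong raised)
               (↔-sym (↔-trans +↔⊎ (↔-refl ⊎-cong ↔-trans +↔⊎ (↔-refl ⊎-cong +↔⊎)))))))

    base : ∀ i → c i 0 ≡ 1
    base zero    =
      size (↔-sym 1↔⊤) (PathsTo-empty (λ _ ())) (PathsTo-empty (appended-none₀ 0)) (PathsTo-empty (raised-none 0))
    base (suc i) = trans
      (size (empty (λ ())) (paths i 0) (PathsTo-empty (appended-none i)) (PathsTo-empty (raised-none (suc i))))
      (trans (+-identityʳ (c i 0)) (base i))

    step₀ : ∀ j → c 0 (suc j) ≡ c 1 j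
    step₀ j = trans
      (size (empty (λ ())) (PathsTo-empty (λ _ ())) (PathsTo-empty (appended-none₀ (suc j))) (raised 0 j))
      (+-identityʳ (c 1 j))

    step : ∀ i j → c (suc i) (suc j) ≡ c i (suc j) + (c i (suc j) + suc (suc i) * c (suc (suc i)) j)
    step i j = size (empty (λ ())) (paths i (suc j)) (appended i j) (raised (suc i) j)

module Solution (c : ℕ → ℕ → ℕ) (recurrence : StandardPaths.Recurrence c) where

  open Rationals
  open FiniteSums
  open PowerSeries
  open Derivation
  open Radicand
  open import Data.Nat as ℕ using (zero; suc; _∸_; _<_; _!)
  open import Data.Nat.Properties using (_!≢0)
  open import Data.Rational using (0ℚ; 1ℚ; _+_; _*_; _-_)
  open import Data.Rational.Properties
  open import Data.Rational.Solver using (module +-*-Solver)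
  open +-*-Solver using (solve; _:+_; _:-_; _:*_; _:=_; con)
  open import Algebra.Bundles using (CommutativeRing)
  open CommutativeRing +-*-commutativeRing using (*-commutativeSemigroup)
  open import Algebra.Properties.CommutativeSemigroup *-commutativeSemigroup using (x∙yz≈y∙xz)
  open import Relation.Binary.PropositionalEquality

  open StandardPaths.Recurrence recurrence

  P : FPS
  P = Pseries c

  P-row₀ : ∀ i → P i 0 ≡ 1ℚ
  P-row₀ i rewrite base i = refl

  C : FPS
  C i j = ι (c i j)

  private
    scaled : ∀ i j → P i j * ι (j !) ≡ C i j
    scaled i j = a/d*d≡a (c i j) (j !) {{j !≢0}}

    ∂y-scaled : ∀ i j → ∂y P i j * ι (j !) ≡ C i (suc j)
    ∂y-scaled i j = begin
      ι (suc j) * P i (suc j) * ι (j !)   ≡⟨ *-assoc (ι (suc j)) (P i (suc j)) (ι (j !)) ⟩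
      ι (suc j) * (P i (suc j) * ι (j !)) ≡⟨ x∙yz≈y∙xz (ι (suc j)) (P i (suc j)) (ι (j !)) ⟩
      P i (suc j) * (ι (suc j) * ι (j !)) ≡⟨ cong (P i (suc j) *_) (sym (ι-* (suc j) (j !))) ⟩
      P i (suc j) * ι (suc j !)           ≡⟨ scaled i (suc j) ⟩
      C i (suc j)                         ∎
      where open ≡-Reasoning

    D-scaled : ∀ i j → D P i j * ι (j !) ≡ ι (suc i) * C (suc i) j - C i (suc j) + ι 2 * mulX C i (suc j)
    D-scaled i j = begin
      (∂x P i j - ∂y P i j + ι 2 * mulX (∂y P) i j) * ι (j !)
        ≡⟨ solve 6 (λ k p d t m f → (k :* p :- d :+ t :* m) :* f := k :* (p :* f) :- d :* f :+ t :* (m :* f)) refl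
             (ι (suc i)) (P (suc i) j) (∂y P i j) (ι 2) (mulX (∂y P) i j) (ι (j !)) ⟩
      ι (suc i) * (P (suc i) j * ι (j !)) - ∂y P i j * ι (j !) + ι 2 * (mulX (∂y P) i j * ι (j !))
        ≡⟨ cong₂ _+_ (cong₂ (λ p d → ι (suc i) * p - d) (scaled (suc i) j) (∂y-scaled i j))
                     (cong (ι 2 *_) (diagonal i)) ⟩
      ι (suc i) * C (suc i) j - C i (suc j) + ι 2 * mulX C i (suc j) ∎
      where
      open ≡-Reasoning
      diagonal : ∀ i → mulX (∂y P) i j * ι (j !) ≡ mulX C i (suc j)
      diagonal zero    = *-zeroˡ (ι (j !))
      diagonal (suc i) = ∂y-scaled i j

  C-recurrence : ∀ i j → ι (suc i) * C (suc i) j - C i (suc j) + ι 2 * mulX C i (suc j) ≡ 0ℚ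
  C-recurrence zero j = begin
    ι 1 * C 1 j - C 0 (suc j) + ι 2 * 0ℚ ≡⟨ cong (λ n → ι 1 * C 1 j - ι n + ι 2 * 0ℚ) (step₀ j) ⟩
    ι 1 * C 1 j - C 1 j + ι 2 * 0ℚ
      ≡⟨ solve 1 (λ x → con (ι 1) :* x :- x :+ con (ι 2) :* con 0ℚ := con 0ℚ) refl (C 1 j) ⟩
    0ℚ                                   ∎
    where open ≡-Reasoning
  C-recurrence (suc i) j = begin
    ι (2 ℕ.+ i) * C (2 ℕ.+ i) j - C (suc i) (suc j) + ι 2 * C i (suc j)
      ≡⟨ cong (λ n → ι (2 ℕ.+ i) * C (2 ℕ.+ i) j - n + ι 2 * C i (suc j)) (trans (cong ι (step i j)) ι-step) ⟩
    ι (2 ℕ.+ i) * C (2 ℕ.+ i) j - (C i (suc j) + (C i (suc j) + ι (2 ℕ.+ i) * C (2 ℕ.+ i) j)) + ι 2 * C i (suc j)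
      ≡⟨ solve 3 (λ a x y → a :* x :- (y :+ (y :+ a :* x)) :+ con (ι 2) :* y := con 0ℚ) refl
           (ι (2 ℕ.+ i)) (C (2 ℕ.+ i) j) (C i (suc j)) ⟩
    0ℚ ∎
    where
    open ≡-Reasoning
    ι-step : ι (c i (suc j) ℕ.+ (c i (suc j) ℕ.+ (2 ℕ.+ i) ℕ.* c (2 ℕ.+ i) j)) ≡
             C i (suc j) + (C i (suc j) + ι (2 ℕ.+ i) * C (2 ℕ.+ i) j)
    ι-step = trans (ι-+ (c i (suc j)) _) (cong (λ r → C i (suc j) + r)
               (trans (ι-+ (c i (suc j)) _) (cong (λ r → C i (suc j) + r) (ι-* (2 ℕ.+ i) (c (2 ℕ.+ i) j)))))

  P-constant : IsConstant P
  P-constant i j = *-cancelʳ-≡ (ι (j !)) {{j !≢0}}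
    (trans (D-scaled i j) (trans (C-recurrence i j) (sym (*-zeroˡ (ι (j !))))))

  S : FPS
  S = 𝟙 ⊖ (ι 2 · (u ⊛ P))

  S-constant : IsConstant S
  S-constant =
    ⊖-constant 𝟙 (ι 2 · (u ⊛ P)) 𝟙-constant (·-constant (ι 2) (u ⊛ P) (⊛-constant u P u-constant P-constant))

  S-row₀ : ∀ i → S i 0 ≡ (𝟙 ⊖ (ι 2 · 𝕩)) i 0
  S-row₀ i = cong (λ s → 𝟙 i 0 - ι 2 * s) (trans (⊛-row₀-partialSums u P P-row₀ i) (u-row₀-partialSums i))

  S²-row₀ : ∀ i → (S ⊛ S) i 0 ≡ radicand i 0
  S²-row₀ i = begin
    (S ⊛ S) i 0                     ≡⟨ ⊛-row₀ S S i ⟩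
    ∑ₐ i (λ a a′ → S a 0 * S a′ 0)  ≡⟨ ∑ₐ-cong i (λ a a′ → cong₂ _*_ (S-row₀ a) (S-row₀ a′)) ⟩
    ∑ₐ i (λ a a′ → s a * s a′)      ≡⟨ squares i ⟩
    radicand i 0                    ∎
    where
    open ≡-Reasoning
    s : ℕ → ℚ
    s a = (𝟙 ⊖ (ι 2 · 𝕩)) a 0
    squares : ∀ i → ∑ₐ i (λ a a′ → s a * s a′) ≡ radicand i 0
    squares 0 = refl
    squares 1 = refl
    squares 2 = refl
    squares (suc (suc (suc k))) = trans (∑<-zero (4 ℕ.+ k) vanishing) (sym (radicand≐ (3 ℕ.+ k) 0))
      where
      vanishing : ∀ a → a < 4 ℕ.+ k → s a * s (3 ℕ.+ k ∸ a) ≡ 0ℚ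
      vanishing 0               _ = refl
      vanishing 1               _ = refl
      vanishing (suc (suc a))   _ = *-zeroˡ (s (suc k ∸ a))

  S-sqrt : IsSqrt radicand S
  S-sqrt = constant-unique (S ⊛ S) radicand (⊛-constant S S S-constant S-constant) radicand-constant S²-row₀ , S-row₀ 0

  P⊛[𝟙⊕S]≐2 : P ⊛ (𝟙 ⊕ S) ≐ ι 2 · 𝟙
  P⊛[𝟙⊕S]≐2 = constant-unique (P ⊛ (𝟙 ⊕ S)) (ι 2 · 𝟙)
    (⊛-constant P (𝟙 ⊕ S) P-constant (⊕-constant 𝟙 S 𝟙-constant S-constant))
    (·-constant (ι 2) 𝟙 𝟙-constant) row₀
    where
    t : ℕ → ℚ
    t a = 𝟙 a 0 + (𝟙 ⊖ (ι 2 · 𝕩)) a 0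
    sums : ∀ i → ∑< (suc i) t ≡ ι 2 * 𝟙 i 0
    sums 0 = refl
    sums 1 = refl
    sums (suc (suc k)) = cong (λ r → t 0 + (t 1 + r)) (∑<-zero (suc k) (λ _ _ → refl))
    row₀ : ∀ i → (P ⊛ (𝟙 ⊕ S)) i 0 ≡ ι 2 * 𝟙 i 0
    row₀ i = begin
      (P ⊛ (𝟙 ⊕ S)) i 0            ≡⟨ ⊛-comm P (𝟙 ⊕ S) i 0 ⟩
      ((𝟙 ⊕ S) ⊛ P) i 0            ≡⟨ ⊛-row₀-partialSums (𝟙 ⊕ S) P P-row₀ i ⟩
      ∑< (suc i) (λ a → 𝟙 a 0 + S a 0) ≡⟨ ∑<-cong (suc i) (λ a _ → cong (λ s → 𝟙 a 0 + s) (S-row₀ a)) ⟩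
      ∑< (suc i) t                 ≡⟨ sums i ⟩
      ι 2 * 𝟙 i 0                  ∎
      where open ≡-Reasoning

mainTheorem5 : (c : ℕ → ℕ → ℕ) → Counts c →
    Σ FPS (IsSqrt radicand) ×
    ((S : FPS) → IsSqrt radicand S →
      ∀ i j → (Pseries c ⊛ (𝟙 ⊕ S)) i j ≡ ((+ 2 / 1) · 𝟙) i j)
mainTheorem5 c counts = (S , S-sqrt) , λ S′ S′-sqrt i j →
  let S′≐S = sqrt-unique {radicand} {S} {S′} S-sqrt S′-sqrt in begin
  (P ⊛ (𝟙 ⊕ S′)) i j
    ≡⟨ ⊛-cong {F = P} (λ _ _ → refl) (⊕-cong {F = 𝟙} (λ _ _ → refl) S′≐S) i j ⟩
  (P ⊛ (𝟙 ⊕ S)) i j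
    ≡⟨ P⊛[𝟙⊕S]≐2 i j ⟩
  ((+ 2 / 1) · 𝟙) i j ∎
  where
  open ≡-Reasoning
  open PowerSeries
  open Solution c (StandardPaths.recurrence c counts)
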